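{- Let $G$ be an MP-forest with multipath matroid $M_G$ and rank function $r$. Then for every non-negative integer $k$, $$k^{p_0(G)}\,T_{M_G}(1-k,0)=(-1)^{r(E(G))}\,\tau_G(k),$$ where $p_0(G)$ is the number of connected components of $G$.
   Context: Digraphs: finite, at most one edge $(v,w)$ from $v$ to $w$ for distinct $v,w$. A multipath is a spanning subgraph each of whose connected components is a vertex or a simple path (sequence of non-loop edges, target of each = source of next, no repeated vertex, not closing into a cycle); $M_G=(E(G),\mathrm{Mult}(G))$, rank $r(A)$ = largest size of a multipath in $A$. An MP-digraph satisfies (MP1) no subgraph isomorphic to $D_A$ (vertices $v_0,v_1,v_2$, edges $(v_1,v_0),(v_0,v_2),(v_1,v_2)$) or $D_B$ (vertices $v_0,\dots,v_3$, edges $(v_0,v_1),(v_2,v_1),(v_2,v_3)$) or their edge-reversals, and (MP2) every coherently oriented cycle of length $\ge2$ is a connected component; then $M_G$ is a matroid. An MP-forest is an MP-digraph whose underlying undirected graph is a forest. Tutte polynomial: $T_M(x,y)=\sum_{A\subseteq X}(x-1)^{r(X)-r(A)}(y-1)^{|A|-r(A)}$. A flowing $k$-colouring of a digraph $H$ is a map $c:V(H)\to\{1,\dots,k\}$ with $c(v)\ne c(w)$ for each edge $(v,w)$, $c(v)=c(v')$ whenever $(v,w),(v',w)$ are edges, and $c(v)=c(v')$ whenever $(w,v),(w,v')$ are edges; $\tau_H(k)$ is their number. -}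

module Defs where

open import Data.Nat using (ℕ; zero; suc; _≤_; _∸_)
open import Data.Integer as ℤ using (ℤ; +_; _-_; _*_; _^_)
open import Data.Fin using (Fin; zero; suc; inject₁; fromℕ)
open import Data.Fin.Properties using (_≟_)
open import Data.Fin.Subset using (Subset; inside; outside; _∈_; _⊆_; ∣_∣; ⊤)
open import Data.Vec using (Vec; []; _∷_; lookup)
open import Data.List using (List; []; _∷_; concat; concatMap; length; filter; map; allFin)
open import Data.List.Membership.Propositional renaming (_∈_ to _∈ₗ_)
open import Data.List.Relation.Unary.Unique.Propositional using (Unique)
open import Data.Product using (Σ; ∃; _×_; _,_; proj₁; proj₂)
open import Data.Sum using (_⊎_)
open import Data.Bool using (Bool; true; false; _∧_; _∨_; not; if_then_else_)
open import Relation.Binary.PropositionalEquality using (_≡_; _≢_)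
open import Relation.Binary.Construct.Closure.ReflexiveTransitive using (Star)
open import Relation.Nullary using (¬_)
open import Relation.Nullary.Decidable using (⌊_⌋)
open import Function using (_∘_)
open import Function.Bundles using (_⇔_)
open import Function.Definitions using (Injective; Surjective)

-- Finite digraphs: vertex set Fin n, edge set Fin m, edge i = (source, target).
-- Injectivity of `edge` = at most one edge from v to w.

record Digraph : Set where
  field
    n        : ℕ
    m        : ℕ
    edge     : Fin m → Fin n × Fin n
    edge-inj : Injective _≡_ _≡_ edge

  src tgt : Fin m → Fin n
  src = proj₁ ∘ edge
  tgt = proj₂ ∘ edge

  HasEdge : Fin n → Fin n → Set
  HasEdge v w = ∃ λ i → edge i ≡ (v , w)

open Digraph public

-- A (directed) path is given by its vertex sequence; its edges
-- are the consecutive pairs.  An edge set B (a subset of E(G)) is a multipath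
-- iff the spanning subgraph (V(G), B) is a vertex-disjoint union of simple
-- directed paths (plus isolated vertices): there is a family of vertex
-- sequences, with no vertex repeated anywhere in the family, whose
-- consecutive pairs are exactly the edges of B.

consec : ∀ {A : Set} → List A → List (A × A)
consec []           = []
consec (x ∷ [])     = []
consec (x ∷ y ∷ xs) = (x , y) ∷ consec (y ∷ xs)

IsMultipath : (G : Digraph) → Subset (m G) → Set
IsMultipath G B =
  Σ (List (List (Fin (n G)))) λ ps →
    Unique (concat ps) ×
    (∀ i → (i ∈ B) ⇔ (edge G i ∈ₗ concatMap consec ps))

-- t is the rank of A in M_G: the largest size of a multipath contained in A.
IsRankOf : (G : Digraph) → Subset (m G) → ℕ → Set
IsRankOf G A t =
  (Σ (Subset (m G)) λ B → B ⊆ A × IsMultipath G B × ∣ B ∣ ≡ t) ×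
  (∀ B → B ⊆ A → IsMultipath G B → ∣ B ∣ ≤ t)

IsRankFunction : (G : Digraph) → (Subset (m G) → ℕ) → Set
IsRankFunction G r = ∀ A → IsRankOf G A (r A)

-- Forbidden subgraphs (MP1).  A subgraph isomorphic to a pattern = an
-- injective image of the pattern's vertices whose pattern edges are present.

ContainsDA : Digraph → Set
ContainsDA G = ∃ λ v0 → ∃ λ v1 → ∃ λ v2 →
  v0 ≢ v1 × v0 ≢ v2 × v1 ≢ v2 ×
  HasEdge G v1 v0 × HasEdge G v0 v2 × HasEdge G v1 v2

ContainsDArev : Digraph → Set
ContainsDArev G = ∃ λ v0 → ∃ λ v1 → ∃ λ v2 →
  v0 ≢ v1 × v0 ≢ v2 × v1 ≢ v2 ×
  HasEdge G v0 v1 × HasEdge G v2 v0 × HasEdge G v2 v1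

ContainsDB : Digraph → Set
ContainsDB G = ∃ λ v0 → ∃ λ v1 → ∃ λ v2 → ∃ λ v3 →
  v0 ≢ v1 × v0 ≢ v2 × v0 ≢ v3 × v1 ≢ v2 × v1 ≢ v3 × v2 ≢ v3 ×
  HasEdge G v0 v1 × HasEdge G v2 v1 × HasEdge G v2 v3

ContainsDBrev : Digraph → Set
ContainsDBrev G = ∃ λ v0 → ∃ λ v1 → ∃ λ v2 → ∃ λ v3 →
  v0 ≢ v1 × v0 ≢ v2 × v0 ≢ v3 × v1 ≢ v2 × v1 ≢ v3 × v2 ≢ v3 ×
  HasEdge G v1 v0 × HasEdge G v1 v2 × HasEdge G v3 v2

MP1 : Digraph → Set
MP1 G = ¬ ContainsDA G × ¬ ContainsDArev G × ¬ ContainsDB G × ¬ ContainsDBrev G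

record DirCycle (G : Digraph) (l : ℕ) : Set where
  field
    vs     : Fin (suc l) → Fin (n G)
    es     : Fin l → Fin (m G)
    closed : vs (fromℕ l) ≡ vs zero
    vs-inj : Injective _≡_ _≡_ (vs ∘ inject₁)
    es-inj : Injective _≡_ _≡_ es
    along  : ∀ j → edge G (es j) ≡ (vs (inject₁ j) , vs (suc j))

  OnCycle : Fin (n G) → Set
  OnCycle v = ∃ λ (j : Fin l) → vs (inject₁ j) ≡ v

-- The cycle is a connected component of G: every edge of G incident to a
-- vertex of the cycle is an edge of the cycle.
IsComponentCycle : (G : Digraph) {l : ℕ} → DirCycle G l → Set
IsComponentCycle G {l} C =
  ∀ i → (OnCycle (src G i) ⊎ OnCycle (tgt G i)) → ∃ λ (j : Fin l) → es j ≡ i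
  where open DirCycle C

MP2 : Digraph → Set
MP2 G = ∀ l → 2 ≤ l → (C : DirCycle G l) → IsComponentCycle G C

MPDigraph : Digraph → Set
MPDigraph G = MP1 G × MP2 G

-- A cycle
-- of length l ≥ 1 in the underlying multigraph: closed vertex sequence with
-- vs 0 … vs (l-1) distinct, distinct edges es j joining vs j and vs (j+1)
-- in either direction (l = 1: a loop; l = 2: two edges between two vertices).

record UndirCycle (G : Digraph) (l : ℕ) : Set where
  field
    vs     : Fin (suc l) → Fin (n G)
    es     : Fin l → Fin (m G)
    closed : vs (fromℕ l) ≡ vs zero
    vs-inj : Injective _≡_ _≡_ (vs ∘ inject₁)
    es-inj : Injective _≡_ _≡_ es
    joins  : ∀ j → (edge G (es j) ≡ (vs (inject₁ j) , vs (suc j)))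
                 ⊎ (edge G (es j) ≡ (vs (suc j) , vs (inject₁ j)))

IsForest : Digraph → Set
IsForest G = ∀ l → 1 ≤ l → ¬ UndirCycle G l

MPForest : Digraph → Set
MPForest G = MPDigraph G × IsForest G

Adj : (G : Digraph) → Fin (n G) → Fin (n G) → Set
Adj G u v = HasEdge G u v ⊎ HasEdge G v u

Connected : (G : Digraph) → Fin (n G) → Fin (n G) → Set
Connected G = Star (Adj G)

-- p is the number of connected components of G: the components are the
-- fibres of a surjection onto Fin p.
IsNumComponents : Digraph → ℕ → Set
IsNumComponents G p =
  Σ (Fin (n G) → Fin p) λ c → Surjective _≡_ _≡_ c ×
    (∀ u v → (c u ≡ c v) ⇔ Connected G u v)

sumSubsets : ∀ k → (Subset k → ℤ) → ℤ
sumSubsets zero    f = f []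
sumSubsets (suc k) f = sumSubsets k (λ A → f (outside ∷ A)) ℤ.+ sumSubsets k (λ A → f (inside ∷ A))

TutteAt : (G : Digraph) → (Subset (m G) → ℕ) → ℤ → ℤ → ℤ
TutteAt G r x y =
  sumSubsets (m G) λ A →
    (x - + 1) ^ (r ⊤ ∸ r A) * (y - + 1) ^ (∣ A ∣ ∸ r A)

_==_ : ∀ {t} → Fin t → Fin t → Bool
a == b = ⌊ a ≟ b ⌋

allL : ∀ {A : Set} → (A → Bool) → List A → Bool
allL P []       = true
allL P (x ∷ xs) = P x ∧ allL P xs

allB : ∀ {t} → (Fin t → Bool) → Bool
allB P = allL P (allFin _)

isFlowing : (G : Digraph) {k : ℕ} → (Fin (n G) → Fin k) → Bool
isFlowing G c =
  allB λ i → not (c (src G i) == c (tgt G i)) ∧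
  allB λ j → (not (tgt G i == tgt G j) ∨ (c (src G i) == c (src G j))) ∧
             (not (src G i == src G j) ∨ (c (tgt G i) == c (tgt G j)))

allVecs : ∀ t k → List (Vec (Fin k) t)
allVecs zero    k = [] ∷ []
allVecs (suc t) k = concatMap (λ x → map (x ∷_) (allVecs t k)) (allFin k)

countTrue : ∀ {A : Set} → (A → Bool) → List A → ℕ
countTrue P []       = 0
countTrue P (x ∷ xs) = if P x then suc (countTrue P xs) else countTrue P xs

τ : Digraph → ℕ → ℕ
τ G k = countTrue (λ v → isFlowing G (lookup v)) (allVecs (n G) k)

-- Induction on the number of edges, deleting an edge e = (u , v).  As G is a forest, u and v
-- lie in different components of G ∖ e, which therefore has one component more; this extra
-- factor k is cancelled at the end (k = 0 is trivial).
--
-- If no other edge leaves u or enters v, then e can be added to every multipath, so e is a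
-- coloop of M_G and T_G(x,0) = x T_{G∖e}(x,0); the flowing colourings of G are those of
-- G ∖ e with c(u) ≠ c(v).  If another edge f leaves u (or enters v), then MP1 makes e and f
-- parallel in M_G: the subsets containing e cancel in pairs A, A △ {f}, so
-- T_G(x,0) = T_{G∖e}(x,0), and the flowing colourings of G are those of G ∖ e with
-- c(v) = c(tgt f) (or c(u) = c(src f)).  In both cases, permuting the colours on the component
-- of v in G ∖ e shows that c(v) is equal to a prescribed colour of the other component for
-- exactly a 1/k fraction of the flowing colourings of G ∖ e.
module Submission where

open import Defs

module SubsetUpdates where
  open import Data.Nat using (ℕ; suc; _≤_)
  open import Data.Nat.Properties using (≤-reflexive; ≤-trans; n≤1+n)
  open import Data.Bool using (true; false; not)
  open import Data.Bool.Properties using (not-involutive)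
  open import Data.Fin using (zero; suc)
  open import Data.Fin.Subset using (Subset; inside; outside; _∈_; _∉_; ∣_∣)
  open import Data.Vec using (_∷_; lookup; _[_]≔_; _[_]%=_)
  open import Data.Vec.Properties
    using ([]=⇒lookup; lookup⇒[]=; lookup∘updateAt; lookup∘updateAt′; []≔-updates; []≔-minimal; []=-injective; updateAt-id-local; updateAt-cong-local; []%=-∘)
  open import Relation.Nullary using (yes; no; contradiction)
  open import Data.Sum using (_⊎_; inj₁; inj₂)
  open import Data.Product using (_×_; _,_)
  open import Data.Fin.Properties using (_≟_)
  open import Relation.Binary.PropositionalEquality using (_≡_; _≢_; refl; sym; trans; cong)

  private
    variable
      k : ℕ

  ∈-[]≔⁻ : ∀ (A : Subset k) {i j} {x} → j ∈ A [ i ]≔ x → j ≢ i → j ∈ A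
  ∈-[]≔⁻ A {i} {j} j∈ j≢i = lookup⇒[]= j A (trans (sym (lookup∘updateAt′ j i j≢i A)) ([]=⇒lookup j∈))

  i∉A[i]≔outside : ∀ (A : Subset k) i → i ∉ A [ i ]≔ outside
  i∉A[i]≔outside A i i∈ with []=-injective ([]≔-updates A i) i∈
  ... | ()

  []≔-lookup′ : ∀ (A : Subset k) i {x} → lookup A i ≡ x → A [ i ]≔ x ≡ A
  []≔-lookup′ A i eq = updateAt-id-local i A (sym eq)

  ∣[]≔inside∣ : ∀ (A : Subset k) i → ∣ A [ i ]≔ inside ∣ ≡ suc ∣ A [ i ]≔ outside ∣
  ∣[]≔inside∣ (x ∷ A) zero    = refl
  ∣[]≔inside∣ (true  ∷ A) (suc i) = cong suc (∣[]≔inside∣ A i)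
  ∣[]≔inside∣ (false ∷ A) (suc i) = ∣[]≔inside∣ A i

  ∣insert∣ : ∀ (A : Subset k) {i} → i ∉ A → ∣ A [ i ]≔ inside ∣ ≡ suc ∣ A ∣
  ∣insert∣ A {i} i∉A with lookup A i in eq
  ... | true  = contradiction (lookup⇒[]= i A eq) i∉A
  ... | false = trans (∣[]≔inside∣ A i) (cong (λ B → suc ∣ B ∣) ([]≔-lookup′ A i eq))

  ∣remove∣ : ∀ (A : Subset k) {i} → i ∈ A → ∣ A ∣ ≡ suc ∣ A [ i ]≔ outside ∣
  ∣remove∣ A {i} i∈A = trans (cong ∣_∣ (sym ([]≔-lookup′ A i ([]=⇒lookup i∈A)))) (∣[]≔inside∣ A i)

  ∣A∣≤1+∣remove∣ : ∀ (A : Subset k) i → ∣ A ∣ ≤ suc ∣ A [ i ]≔ outside ∣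
  ∣A∣≤1+∣remove∣ A i with lookup A i in eq
  ... | true  = ≤-reflexive (∣remove∣ A (lookup⇒[]= i A eq))
  ... | false = ≤-trans (≤-reflexive (cong ∣_∣ (sym ([]≔-lookup′ A i eq)))) (n≤1+n _)

  ∉⇒lookup≡outside : ∀ (A : Subset k) {i} → i ∉ A → lookup A i ≡ outside
  ∉⇒lookup≡outside A {i} i∉A with lookup A i in eq
  ... | true  = contradiction (lookup⇒[]= i A eq) i∉A
  ... | false = refl

  []%=not-involutive : ∀ (A : Subset k) i → A [ i ]%= not [ i ]%= not ≡ A
  []%=not-involutive A i = trans ([]%=-∘ A i) (updateAt-id-local i A (not-involutive (lookup A i)))

  []%=not-∉ : ∀ (A : Subset k) {i} → i ∉ A → A [ i ]%= not ≡ A [ i ]≔ inside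
  []%=not-∉ A {i} i∉A = updateAt-cong-local i A (cong not (∉⇒lookup≡outside A i∉A))

  ∈⇒∉[]%=not : ∀ (A : Subset k) {i} → i ∈ A → i ∉ A [ i ]%= not
  ∈⇒∉[]%=not A {i} i∈A i∈ with trans (sym ([]=⇒lookup i∈)) (trans (lookup∘updateAt i A) (cong not ([]=⇒lookup i∈A)))
  ... | ()

  ∈-[]≔inside⁻ : ∀ (A : Subset k) {i j} → j ∈ A [ i ]≔ inside → j ∈ A ⊎ j ≡ i
  ∈-[]≔inside⁻ A {i} {j} j∈ with j ≟ i
  ... | yes j≡i = inj₂ j≡i
  ... | no  j≢i = inj₁ (∈-[]≔⁻ A j∈ j≢i)

  ∈-[]≔inside⁺ : ∀ (A : Subset k) {i j} → j ∈ A ⊎ j ≡ i → j ∈ A [ i ]≔ inside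
  ∈-[]≔inside⁺ A {i} {j} (inj₁ j∈A) with j ≟ i
  ... | yes refl = []≔-updates A i
  ... | no  j≢i  = []≔-minimal A j i j≢i j∈A
  ∈-[]≔inside⁺ A {i} (inj₂ refl) = []≔-updates A i

  ∈-[]≔outside⁻ : ∀ (A : Subset k) {i j} → j ∈ A [ i ]≔ outside → j ∈ A × j ≢ i
  ∈-[]≔outside⁻ A {i} j∈ = ∈-[]≔⁻ A j∈ j≢i , j≢i
    where
    j≢i : _ ≢ i
    j≢i refl = i∉A[i]≔outside A i j∈

module Counting where
  open import Data.Nat using (ℕ; zero; suc; _+_; _*_; _^_)
  open import Data.Nat.Properties using (+-suc; *-zeroʳ; +-0-commutativeMonoid)
  open import Data.Bool using (Bool; true; false; not; _∧_; if_then_else_)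
  open import Data.Fin using (Fin; zero; suc)
  open import Data.Fin.Properties using (_≟_)
  open import Data.Vec using (Vec; []; _∷_)
  open import Data.Vec.Properties using (∷-injective)
  open import Data.List using (List; []; _∷_; _++_; concat; map; allFin; cartesianProductWith; length)
  open import Data.List.Properties using (length-++; length-map; length-tabulate)
  open import Data.List.Membership.Propositional using (_∈_)
  open import Data.List.Membership.Propositional.Properties using (∈-allFin; ∈-map⁺; ∈-cartesianProductWith⁺)
  open import Data.List.Membership.Propositional.Properties.WithK using (unique∧set⇒bag)
  open import Data.List.Relation.Unary.Any using (here)
  open import Data.List.Relation.Unary.All using ([])
  open import Data.List.Relation.Unary.AllPairs using ([]; _∷_)
  open import Data.List.Relation.Unary.Unique.Propositional using (Unique)
  open import Data.List.Relation.Unary.Unique.Propositional.Properties using (cartesianProductWith⁺; allFin⁺; map⁺)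
  open import Data.List.Relation.Binary.Permutation.Propositional using (_↭_; refl; prep; swap; trans)
  open import Data.List.Relation.Binary.BagAndSetEquality using (∼bag⇒↭)
  open import Algebra.Properties.CommutativeMonoid.Sum +-0-commutativeMonoid using (sum-syntax; sum-cong-≗; ∑-distrib-+)
  open import Function.Bundles using (mk⇔)
  open import Relation.Nullary using (_because_)
  open import Relation.Binary.PropositionalEquality as ≡ using (_≡_; cong; cong₂; subst)
  open ≡.≡-Reasoning

  private
    variable
      A B : Set

  countTrue-cong : ∀ {P Q : A → Bool} → (∀ x → P x ≡ Q x) → ∀ xs → countTrue P xs ≡ countTrue Q xs
  countTrue-cong P≗Q []       = ≡.refl
  countTrue-cong P≗Q (x ∷ xs) rewrite P≗Q x = cong (λ n → if _ then suc n else n) (countTrue-cong P≗Q xs)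

  countTrue-map : ∀ (P : B → Bool) (f : A → B) xs → countTrue P (map f xs) ≡ countTrue (λ x → P (f x)) xs
  countTrue-map P f []       = ≡.refl
  countTrue-map P f (x ∷ xs) = cong (λ n → if P (f x) then suc n else n) (countTrue-map P f xs)

  countTrue-↭ : ∀ (P : A → Bool) {xs ys} → xs ↭ ys → countTrue P xs ≡ countTrue P ys
  countTrue-↭ P refl         = ≡.refl
  countTrue-↭ P (prep x p)   = cong (λ n → if P x then suc n else n) (countTrue-↭ P p)
  countTrue-↭ P (swap x y p) with P x | P y
  ... | true  | true  = cong (λ n → suc (suc n)) (countTrue-↭ P p)
  ... | true  | false = cong suc (countTrue-↭ P p)
  ... | false | true  = cong suc (countTrue-↭ P p)
  ... | false | false = countTrue-↭ P p
  countTrue-↭ P (trans p q)  = ≡.trans (countTrue-↭ P p) (countTrue-↭ P q)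

  countTrue-true : ∀ (xs : List A) → countTrue (λ _ → true) xs ≡ length xs
  countTrue-true []       = ≡.refl
  countTrue-true (x ∷ xs) = cong suc (countTrue-true xs)

  countTrue-∧-split : ∀ (P Q : A → Bool) xs →
    countTrue P xs ≡ countTrue (λ x → P x ∧ Q x) xs + countTrue (λ x → P x ∧ not (Q x)) xs
  countTrue-∧-split P Q []       = ≡.refl
  countTrue-∧-split P Q (x ∷ xs) with P x | Q x
  ... | true  | true  = cong suc (countTrue-∧-split P Q xs)
  ... | true  | false = ≡.trans (cong suc (countTrue-∧-split P Q xs)) (≡.sym (+-suc _ _))
  ... | false | _     = countTrue-∧-split P Q xs

  indicator : Bool → ℕ
  indicator b = if b then 1 else 0

  ∑-const : ∀ k c → ∑[ t < k ] c ≡ k * c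
  ∑-const zero    c = ≡.refl
  ∑-const (suc k) c = cong (c +_) (∑-const k c)

  ∑-indicator-== : ∀ {k} (s : Fin k) → ∑[ t < k ] indicator (s == t) ≡ 1
  ∑-indicator-== {suc k} zero    = cong suc (≡.trans (∑-const k 0) (*-zeroʳ k))
  ∑-indicator-== {suc k} (suc s) = ≡.trans (sum-cong-≗ (λ t → cong indicator (suc-== s t))) (∑-indicator-== s)
    where
    suc-== : ∀ {k} (s t : Fin k) → (suc s == suc t) ≡ (s == t)
    suc-== s t with s ≟ t
    ... | true  because _ = ≡.refl
    ... | false because _ = ≡.refl

  countTrue-∷ : ∀ (P : A → Bool) x xs → countTrue P (x ∷ xs) ≡ indicator (P x) + countTrue P xs
  countTrue-∷ P x xs with P x
  ... | true  = ≡.refl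
  ... | false = ≡.refl

  countTrue-fibres : ∀ {k} (P : A → Bool) (g : A → Fin k) xs →
    countTrue P xs ≡ ∑[ t < k ] countTrue (λ x → P x ∧ (g x == t)) xs
  countTrue-fibres {k = k} P g []       = ≡.sym (≡.trans (∑-const k 0) (*-zeroʳ k))
  countTrue-fibres {A = A} {k = k} P g (x ∷ xs) = begin
    countTrue P (x ∷ xs)
      ≡⟨ countTrue-∷ P x xs ⟩
    indicator (P x) + countTrue P xs
      ≡⟨ cong₂ _+_ (∑-indicator-∧ (P x)) (≡.sym (countTrue-fibres P g xs)) ⟨
    ∑[ t < k ] indicator (P x ∧ (g x == t)) + ∑[ t < k ] countTrue (Pₜ t) xs
      ≡⟨ ∑-distrib-+ (λ t → indicator (P x ∧ (g x == t))) (λ t → countTrue (Pₜ t) xs) ⟨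
    ∑[ t < k ] (indicator (P x ∧ (g x == t)) + countTrue (Pₜ t) xs)
      ≡⟨ sum-cong-≗ (λ t → countTrue-∷ (Pₜ t) x xs) ⟨
    ∑[ t < k ] countTrue (Pₜ t) (x ∷ xs)
      ∎
    where
    Pₜ : Fin k → A → Bool
    Pₜ t y = P y ∧ (g y == t)
    ∑-indicator-∧ : ∀ b → ∑[ t < k ] indicator (b ∧ (g x == t)) ≡ indicator b
    ∑-indicator-∧ true  = ∑-indicator-== (g x)
    ∑-indicator-∧ false = ≡.trans (∑-const k 0) (*-zeroʳ k)

  allVecs-suc : ∀ t k → allVecs (suc t) k ≡ cartesianProductWith _∷_ (allFin k) (allVecs t k)
  allVecs-suc t k = concatMap-map (allFin k)
    where
    concatMap-map : ∀ (xs : List (Fin k)) →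
      concat (map (λ x → map (x ∷_) (allVecs t k)) xs) ≡ cartesianProductWith _∷_ xs (allVecs t k)
    concatMap-map []       = ≡.refl
    concatMap-map (x ∷ xs) = cong (map (x ∷_) (allVecs t k) ++_) (concatMap-map xs)

  length-cartesianProductWith : ∀ {C : Set} (f : A → B → C) xs ys →
    length (cartesianProductWith f xs ys) ≡ length xs * length ys
  length-cartesianProductWith f []       ys = ≡.refl
  length-cartesianProductWith f (x ∷ xs) ys = begin
    length (map (f x) ys ++ cartesianProductWith f xs ys)
      ≡⟨ length-++ (map (f x) ys) ⟩
    length (map (f x) ys) + length (cartesianProductWith f xs ys)
      ≡⟨ cong₂ _+_ (length-map (f x) ys) (length-cartesianProductWith f xs ys) ⟩
    length ys + length xs * length ys
      ∎

  length-allVecs : ∀ t k → length (allVecs t k) ≡ k ^ t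
  length-allVecs zero    k = ≡.refl
  length-allVecs (suc t) k = begin
    length (allVecs (suc t) k)
      ≡⟨ cong length (allVecs-suc t k) ⟩
    length (cartesianProductWith _∷_ (allFin k) (allVecs t k))
      ≡⟨ length-cartesianProductWith _∷_ (allFin k) (allVecs t k) ⟩
    length (allFin k) * length (allVecs t k)
      ≡⟨ cong₂ _*_ (length-tabulate {n = k} (λ i → i)) (length-allVecs t k) ⟩
    k * k ^ t
      ∎

  allVecs-unique : ∀ t k → Unique (allVecs t k)
  allVecs-unique zero    k = [] ∷ []
  allVecs-unique (suc t) k = subst Unique (≡.sym (allVecs-suc t k))
    (cartesianProductWith⁺ _∷_ ∷-injective (allFin⁺ k) (allVecs-unique t k))

  ∈-allVecs : ∀ {t k} (v : Vec (Fin k) t) → v ∈ allVecs t k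
  ∈-allVecs []                = here ≡.refl
  ∈-allVecs {suc t} {k} (x ∷ v) = subst (x ∷ v ∈_) (≡.sym (allVecs-suc t k))
    (∈-cartesianProductWith⁺ _∷_ (∈-allFin x) (∈-allVecs v))

  countTrue-allVecs-bijection : ∀ {t k} (φ ψ : Vec (Fin k) t → Vec (Fin k) t) →
    (∀ v → ψ (φ v) ≡ v) → (∀ v → φ (ψ v) ≡ v) →
    (Q : Vec (Fin k) t → Bool) → countTrue Q (allVecs t k) ≡ countTrue (λ v → Q (φ v)) (allVecs t k)
  countTrue-allVecs-bijection {t} {k} φ ψ ψφ≗id φψ≗id Q =
    ≡.trans (countTrue-↭ Q allVecs↭φ[allVecs]) (countTrue-map Q φ (allVecs t k))
    where
    φ-injective : ∀ {v w} → φ v ≡ φ w → v ≡ w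
    φ-injective {v} {w} eq = ≡.trans (≡.sym (ψφ≗id v)) (≡.trans (cong ψ eq) (ψφ≗id w))
    ∈-φ[allVecs] : ∀ v → v ∈ map φ (allVecs t k)
    ∈-φ[allVecs] v = subst (_∈ map φ (allVecs t k)) (φψ≗id v) (∈-map⁺ φ (∈-allVecs (ψ v)))
    allVecs↭φ[allVecs] : allVecs t k ↭ map φ (allVecs t k)
    allVecs↭φ[allVecs] = ∼bag⇒↭ (unique∧set⇒bag (allVecs-unique t k) (map⁺ φ-injective (allVecs-unique t k))
      (mk⇔ (λ _ → ∈-φ[allVecs] _) (λ _ → ∈-allVecs _)))

module FlowingColourings where
  open import Data.Nat using (ℕ)
  open import Data.Bool using (Bool; true; false; T; not; _∧_; _∨_)
  open import Data.Bool.Properties using (T-∧; T-∨)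
  open import Data.Fin using (Fin)
  open import Data.Fin.Properties using (_≟_)
  open import Data.List using ([]; _∷_)
  open import Data.List.Relation.Unary.All using (All; []; _∷_)
  open import Data.List.Relation.Unary.All.Properties using (tabulate⁺; tabulate⁻)
  open import Data.Product using (_×_; _,_; proj₁; proj₂)
  open import Data.Sum using (inj₁; inj₂)
  open import Data.Unit using (tt)
  open import Function using (_∘_; id)
  open import Function.Bundles using (_⇔_; mk⇔; Equivalence)
  open import Relation.Nullary using (yes; no; contradiction)
  open import Relation.Nullary.Decidable using (toWitness; fromWitness; toWitnessFalse; fromWitnessFalse)
  open import Relation.Binary.PropositionalEquality using (_≡_; _≢_; refl)

  T-injective : ∀ {a b} → (T a → T b) → (T b → T a) → a ≡ b
  T-injective {false} {false} _ _ = refl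
  T-injective {false} {true}  _ b⇒a = contradiction (b⇒a tt) id
  T-injective {true}  {false} a⇒b _ = contradiction (a⇒b tt) id
  T-injective {true}  {true}  _ _ = refl

  T-allL : ∀ {A : Set} (P : A → Bool) xs → T (allL P xs) ⇔ All (T ∘ P) xs
  T-allL P []       = mk⇔ (λ _ → []) (λ _ → tt)
  T-allL P (x ∷ xs) = mk⇔
    (λ h → let (px , pxs) = Equivalence.to T-∧ h in px ∷ Equivalence.to (T-allL P xs) pxs)
    (λ { (px ∷ pxs) → Equivalence.from T-∧ (px , Equivalence.from (T-allL P xs) pxs) })

  T-allB : ∀ {t} (P : Fin t → Bool) → T (allB P) ⇔ (∀ i → T (P i))
  T-allB P = mk⇔ (λ h → tabulate⁻ (Equivalence.to (T-allL P _) h)) (λ h → Equivalence.from (T-allL P _) (tabulate⁺ h))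

  T-≢ : ∀ {t} {a b : Fin t} → T (not (a == b)) ⇔ (a ≢ b)
  T-≢ {a = a} {b} = mk⇔ (toWitnessFalse {a? = a ≟ b}) fromWitnessFalse

  T-≡⇒≡ : ∀ {t s} {a b : Fin t} {c d : Fin s} → T (not (a == b) ∨ (c == d)) ⇔ (a ≡ b → c ≡ d)
  T-≡⇒≡ {a = a} {b} {c} {d} = mk⇔ to from
    where
    to : T (not (a == b) ∨ (c == d)) → a ≡ b → c ≡ d
    to h a≡b with Equivalence.to T-∨ h
    ... | inj₁ a≢b = contradiction a≡b (toWitnessFalse {a? = a ≟ b} a≢b)
    ... | inj₂ c≡d = toWitness {a? = c ≟ d} c≡d
    from : (a ≡ b → c ≡ d) → T (not (a == b) ∨ (c == d))
    from a≡b⇒c≡d with a ≟ b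
    ... | yes a≡b = fromWitness {a? = c ≟ d} (a≡b⇒c≡d a≡b)
    ... | no  a≢b = tt

  record Flowing (G : Digraph) {k : ℕ} (c : Fin (n G) → Fin k) : Set where
    field
      proper        : ∀ i → c (src G i) ≢ c (tgt G i)
      sources-agree : ∀ i j → tgt G i ≡ tgt G j → c (src G i) ≡ c (src G j)
      targets-agree : ∀ i j → src G i ≡ src G j → c (tgt G i) ≡ c (tgt G j)

  isFlowing⇔Flowing : ∀ G {k} (c : Fin (n G) → Fin k) → T (isFlowing G c) ⇔ Flowing G c
  isFlowing⇔Flowing G c = mk⇔ to from
    where
    to : T (isFlowing G c) → Flowing G c
    to h = record
      { proper        = λ i → Equivalence.to T-≢ (Equivalence.to T-∧ (edge-ok i) .proj₁)
      ; sources-agree = λ i j → Equivalence.to T-≡⇒≡ (pair-ok i j .proj₁)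
      ; targets-agree = λ i j → Equivalence.to T-≡⇒≡ (pair-ok i j .proj₂)
      }
      where
      edge-ok : ∀ i → T (not (c (src G i) == c (tgt G i)) ∧ allB λ j →
        (not (tgt G i == tgt G j) ∨ (c (src G i) == c (src G j))) ∧ (not (src G i == src G j) ∨ (c (tgt G i) == c (tgt G j))))
      edge-ok = Equivalence.to (T-allB _) h
      pair-ok : ∀ i j → T (not (tgt G i == tgt G j) ∨ (c (src G i) == c (src G j))) × T (not (src G i == src G j) ∨ (c (tgt G i) == c (tgt G j)))
      pair-ok i j = Equivalence.to T-∧ (Equivalence.to (T-allB _) (Equivalence.to T-∧ (edge-ok i) .proj₂) j)
    from : Flowing G c → T (isFlowing G c)
    from f = Equivalence.from (T-allB _) λ i → Equivalence.from T-∧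
      ( Equivalence.from T-≢ (proper i)
      , Equivalence.from (T-allB _) λ j → Equivalence.from T-∧
          (Equivalence.from T-≡⇒≡ (sources-agree i j) , Equivalence.from T-≡⇒≡ (targets-agree i j)))
      where open Flowing f

  T-≡ : ∀ {t} {a b : Fin t} → T (a == b) ⇔ (a ≡ b)
  T-≡ {a = a} {b} = mk⇔ (toWitness {a? = a ≟ b}) fromWitness

module ForestWalks where
  open import Data.Nat using (ℕ; zero; suc; s≤s; z≤n)
  open import Data.Fin using (Fin; zero; suc; inject₁; fromℕ; toℕ)
  open import Data.Fin.Properties using (fromℕ≢inject₁; inject₁-injective; toℕ-inject₁)
  import Data.Fin.Properties as Fin
  open import Data.List using (List; []; _∷_)
  open import Data.List.Membership.Propositional using (_∈_)
  open import Data.List.Relation.Unary.Any using (here; there)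
  open import Data.List.Relation.Unary.All using ([]) renaming (lookup to All-lookup)
  open import Data.List.Relation.Unary.All.Properties.Core using (¬Any⇒All¬)
  open import Data.List.Relation.Unary.AllPairs using ([]; _∷_)
  open import Data.List.Relation.Unary.Unique.Propositional using (Unique)
  open import Data.Product using (Σ; _×_; _,_)
  open import Data.Product.Properties using (,-injective)
  open import Data.Sum using (_⊎_; inj₁; inj₂)
  open import Data.Empty using (⊥-elim)
  open import Relation.Nullary using (yes; no)
  open import Relation.Binary.PropositionalEquality using (_≡_; _≢_; refl; sym; trans; cong; subst)
  open import Relation.Binary.Construct.Closure.ReflexiveTransitive using (ε; _◅_)

  module _ (G : Digraph) where

    private
      V E : Set
      V = Fin (n G)
      E = Fin (m G)

    open import Data.List.Membership.DecPropositional (Fin._≟_ {n G}) using (_∈?_)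

    Joins : E → V → V → Set
    Joins i x y = edge G i ≡ (x , y) ⊎ edge G i ≡ (y , x)

    data Walk : V → V → Set where
      nil  : ∀ x → Walk x x
      cons : ∀ {x y z} i → Joins i x y → Walk y z → Walk x z

    walkVertices : ∀ {a b} → Walk a b → List V
    walkVertices (nil x)          = x ∷ []
    walkVertices (cons {x} _ _ W) = x ∷ walkVertices W

    walkEdges : ∀ {a b} → Walk a b → List E
    walkEdges (nil x)      = []
    walkEdges (cons i _ W) = i ∷ walkEdges W

    _⊆ᵉ_ : ∀ {a b a′ b′} → Walk a b → Walk a′ b′ → Set
    W ⊆ᵉ W′ = ∀ {i} → i ∈ walkEdges W → i ∈ walkEdges W′

    star⇒walk : ∀ {a b} → Connected G a b → Walk a b
    star⇒walk ε                     = nil _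
    star⇒walk (inj₁ (i , e) ◅ conn) = cons i (inj₁ e) (star⇒walk conn)
    star⇒walk (inj₂ (i , e) ◅ conn) = cons i (inj₂ e) (star⇒walk conn)

    walk-suffix : ∀ {a b x} (W : Walk a b) → x ∈ walkVertices W → Unique (walkVertices W) →
      Σ (Walk x b) λ W′ → Unique (walkVertices W′) × W′ ⊆ᵉ W
    walk-suffix (nil x)      (here refl) u         = nil x , u , λ ()
    walk-suffix (cons i j W) (here refl) u         = cons i j W , u , λ h → h
    walk-suffix (cons i j W) (there x∈W) (_ ∷ u) with walk-suffix W x∈W u
    ... | W′ , u′ , W′⊆W = W′ , u′ , λ h → there (W′⊆W h)

    loop-erase : ∀ {a b} (W : Walk a b) → Σ (Walk a b) λ W′ → Unique (walkVertices W′) × W′ ⊆ᵉ W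
    loop-erase (nil x) = nil x , [] ∷ [] , λ ()
    loop-erase (cons {x} i j W) with loop-erase W
    ... | W′ , u′ , W′⊆W with x ∈? walkVertices W′
    ...   | yes x∈W′ = let (W″ , u″ , W″⊆W′) = walk-suffix W′ x∈W′ u′ in W″ , u″ , λ h → there (W′⊆W (W″⊆W′ h))
    ...   | no  x∉W′ = cons i j W′ , ¬Any⇒All¬ (walkVertices W′) x∉W′ ∷ u′ , λ { (here e) → here e ; (there h) → there (W′⊆W h) }

    Joins-unique : ∀ {i x y x′ y′} → Joins i x y → Joins i x′ y′ → (x ≡ x′ × y ≡ y′) ⊎ (x ≡ y′ × y ≡ x′)
    Joins-unique (inj₁ e) (inj₁ e′) = inj₁ (,-injective (trans (sym e) e′))
    Joins-unique (inj₁ e) (inj₂ e′) = inj₂ (,-injective (trans (sym e) e′))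
    Joins-unique (inj₂ e) (inj₁ e′) = let (y≡x′ , x≡y′) = ,-injective (trans (sym e) e′) in inj₂ (x≡y′ , y≡x′)
    Joins-unique (inj₂ e) (inj₂ e′) = let (y≡y′ , x≡x′) = ,-injective (trans (sym e) e′) in inj₁ (x≡x′ , y≡y′)

    record Path (a b : V) : Set where
      field
        len              : ℕ
        vertex           : Fin (suc len) → V
        edgeAt           : Fin len → E
        vertex-injective : ∀ {s t} → vertex s ≡ vertex t → s ≡ t
        starts           : vertex zero ≡ a
        ends             : vertex (fromℕ len) ≡ b
        joins            : ∀ j → Joins (edgeAt j) (vertex (inject₁ j)) (vertex (suc j))

      edgeAt-injective : ∀ {j j′} → edgeAt j ≡ edgeAt j′ → j ≡ j′
      edgeAt-injective {j} {j′} e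
        with Joins-unique (joins j) (subst (λ i → Joins i (vertex (inject₁ j′)) (vertex (suc j′))) (sym e) (joins j′))
      ... | inj₁ (e₁ , _)  = inject₁-injective (vertex-injective e₁)
      ... | inj₂ (e₁ , e₂) = ⊥-elim (k≢2+k (trans j′≡1+j (cong suc j≡1+j′)))
        where
        j≡1+j′ : toℕ j ≡ suc (toℕ j′)
        j≡1+j′ = trans (sym (toℕ-inject₁ j)) (cong toℕ (vertex-injective e₁))
        j′≡1+j : toℕ j′ ≡ suc (toℕ j)
        j′≡1+j = sym (trans (cong toℕ (vertex-injective e₂)) (toℕ-inject₁ j′))
        k≢2+k : ∀ {k} → k ≢ suc (suc k)
        k≢2+k ()

    private
      trivial-path : ∀ x → Path x x
      trivial-path x = record
        { len = 0 ; vertex = λ _ → x ; edgeAt = λ () ; vertex-injective = λ { {zero} {zero} _ → refl }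
        ; starts = refl ; ends = refl ; joins = λ () }

      extend-path : ∀ {x y b} i → Joins i x y → (P : Path y b) → (∀ t → x ≢ Path.vertex P t) → Path x b
      extend-path {x} i j P x∉P = record
        { len = suc len ; vertex = vertex′ ; edgeAt = edgeAt′ ; vertex-injective = injective
        ; starts = refl ; ends = ends ; joins = joins′ }
        where
        open Path P
        vertex′ : Fin (suc (suc len)) → V
        vertex′ zero    = x
        vertex′ (suc t) = vertex t
        edgeAt′ : Fin (suc len) → E
        edgeAt′ zero    = i
        edgeAt′ (suc t) = edgeAt t
        injective : ∀ {s t} → vertex′ s ≡ vertex′ t → s ≡ t
        injective {zero}  {zero}  _ = refl
        injective {zero}  {suc t} e = ⊥-elim (x∉P t e)
        injective {suc s} {zero}  e = ⊥-elim (x∉P s (sym e))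
        injective {suc s} {suc t} e = cong suc (vertex-injective e)
        joins′ : ∀ t → Joins (edgeAt′ t) (vertex′ (inject₁ t)) (vertex′ (suc t))
        joins′ zero    = subst (Joins i x) (sym starts) j
        joins′ (suc t) = joins t

    walk⇒path : ∀ {a b} (W : Walk a b) → Unique (walkVertices W) →
      Σ (Path a b) λ P → (∀ t → Path.vertex P t ∈ walkVertices W) × (∀ j → Path.edgeAt P j ∈ walkEdges W)
    walk⇒path (nil x)      _        = trivial-path x , (λ _ → here refl) , λ ()
    walk⇒path (cons i j W) (x∉W ∷ u) with walk⇒path W u
    ... | P , vertex∈W , edgeAt∈W =
      extend-path i j P (λ t → All-lookup x∉W (vertex∈W t)) ,
      (λ { zero → here refl ; (suc t) → there (vertex∈W t) }) ,
      (λ { zero → here refl ; (suc t) → there (edgeAt∈W t) })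

    close-path : ∀ {a b} (P : Path a b) c → Joins c b a → (∀ j → Path.edgeAt P j ≢ c) → UndirCycle G (suc (Path.len P))
    close-path {a} {b} P c c-joins c∉P = record
      { vs = vs ; es = es ; closed = ends ; vs-inj = vs-injective ; es-inj = es-injective ; joins = joins′ }
      where
      open Path P
      vs : Fin (suc (suc len)) → V
      vs zero    = b
      vs (suc j) = vertex j
      es : Fin (suc len) → E
      es zero    = c
      es (suc j) = edgeAt j
      vs-injective : ∀ {s t} → vs (inject₁ s) ≡ vs (inject₁ t) → s ≡ t
      vs-injective {zero}  {zero}  _ = refl
      vs-injective {zero}  {suc t} e = ⊥-elim (fromℕ≢inject₁ (vertex-injective (trans ends e)))
      vs-injective {suc s} {zero}  e = ⊥-elim (fromℕ≢inject₁ (vertex-injective (trans ends (sym e))))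
      vs-injective {suc s} {suc t} e = cong suc (inject₁-injective (vertex-injective e))
      es-injective : ∀ {s t} → es s ≡ es t → s ≡ t
      es-injective {zero}  {zero}  _ = refl
      es-injective {zero}  {suc t} e = ⊥-elim (c∉P t (sym e))
      es-injective {suc s} {zero}  e = ⊥-elim (c∉P s e)
      es-injective {suc s} {suc t} e = cong suc (edgeAt-injective e)
      joins′ : ∀ j → Joins (es j) (vs (inject₁ j)) (vs (suc j))
      joins′ zero    = subst (Joins c b) (sym starts) c-joins
      joins′ (suc j) = joins j

    open import Data.List.Membership.DecPropositional (Fin._≟_ {m G}) using () renaming (_∈?_ to _∈ᵉ?_)

    forest-walk-uses-edge : IsForest G → ∀ {a b c} (W : Walk a b) → Joins c b a → c ∈ walkEdges W
    forest-walk-uses-edge forest {c = c} W c-joins with c ∈ᵉ? walkEdges W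
    ... | yes c∈W = c∈W
    ... | no  c∉W with loop-erase W
    ...   | W′ , u′ , W′⊆W with walk⇒path W′ u′
    ...     | P , _ , edgeAt∈W′ = ⊥-elim (forest (suc (Path.len P)) (s≤s z≤n)
                (close-path P c c-joins (λ j e → c∉W (W′⊆W (subst (_∈ walkEdges W′) e (edgeAt∈W′ j))))))

    forest-loopless : IsForest G → ∀ i {x} → edge G i ≢ (x , x)
    forest-loopless forest i {x} e with forest-walk-uses-edge forest (nil x) (inj₁ e)
    ... | ()

module EdgeDeletion where
  open ForestWalks
  open import Data.Nat using (ℕ; zero; suc)
  open import Data.Fin using (Fin; zero; suc)
  open import Data.Fin.Properties using (suc-injective)
  open import Data.List.Membership.Propositional using (_∈_)
  open import Data.List.Relation.Unary.Any using (there)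
  open import Data.Product using (_×_; _,_; proj₁; proj₂)
  open import Data.Sum using (_⊎_; inj₁; inj₂)
  open import Function using (_∘_)
  open import Function.Definitions using (Injective)
  open import Relation.Nullary using (¬_)
  open import Relation.Binary.PropositionalEquality using (_≡_; refl; sym; cong)
  open import Relation.Binary.Construct.Closure.ReflexiveTransitive as Star using (Star)

  module FirstEdge {nn mm : ℕ} (edge₀ : Fin (suc mm) → Fin nn × Fin nn) (edge₀-inj : Injective _≡_ _≡_ edge₀) where

    G : Digraph
    G = record { n = nn ; m = suc mm ; edge = edge₀ ; edge-inj = edge₀-inj }

    G⁻ : Digraph
    G⁻ = record { n = nn ; m = mm ; edge = edge₀ ∘ suc ; edge-inj = suc-injective ∘ edge₀-inj }

    u v : Fin nn
    u = src G zero
    v = tgt G zero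

    HasEdge⁻⇒HasEdge : ∀ {x y} → HasEdge G⁻ x y → HasEdge G x y
    HasEdge⁻⇒HasEdge (i , e) = suc i , e

    Adj⁻⇒Adj : ∀ {x y} → Adj G⁻ x y → Adj G x y
    Adj⁻⇒Adj (inj₁ e) = inj₁ (HasEdge⁻⇒HasEdge e)
    Adj⁻⇒Adj (inj₂ e) = inj₂ (HasEdge⁻⇒HasEdge e)

    connected⁻⇒connected : ∀ {x y} → Connected G⁻ x y → Connected G x y
    connected⁻⇒connected = Star.map Adj⁻⇒Adj

    Adj-cases : ∀ {x y} → Adj G x y → Adj G⁻ x y ⊎ ((x ≡ u × y ≡ v) ⊎ (x ≡ v × y ≡ u))
    Adj-cases (inj₁ (zero  , e)) = inj₂ (inj₁ (cong proj₁ (sym e) , cong proj₂ (sym e)))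
    Adj-cases (inj₁ (suc i , e)) = inj₁ (inj₁ (i , e))
    Adj-cases (inj₂ (zero  , e)) = inj₂ (inj₂ (cong proj₂ (sym e) , cong proj₁ (sym e)))
    Adj-cases (inj₂ (suc i , e)) = inj₁ (inj₂ (i , e))

    MP1⁻ : MP1 G → MP1 G⁻
    MP1⁻ (¬DA , ¬DArev , ¬DB , ¬DBrev) =
      (λ (v₀ , v₁ , v₂ , d₁ , d₂ , d₃ , e₁ , e₂ , e₃) → ¬DA (v₀ , v₁ , v₂ , d₁ , d₂ , d₃ , lift e₁ , lift e₂ , lift e₃)) ,
      (λ (v₀ , v₁ , v₂ , d₁ , d₂ , d₃ , e₁ , e₂ , e₃) → ¬DArev (v₀ , v₁ , v₂ , d₁ , d₂ , d₃ , lift e₁ , lift e₂ , lift e₃)) ,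
      (λ (v₀ , v₁ , v₂ , v₃ , d₁ , d₂ , d₃ , d₄ , d₅ , d₆ , e₁ , e₂ , e₃) →
        ¬DB (v₀ , v₁ , v₂ , v₃ , d₁ , d₂ , d₃ , d₄ , d₅ , d₆ , lift e₁ , lift e₂ , lift e₃)) ,
      (λ (v₀ , v₁ , v₂ , v₃ , d₁ , d₂ , d₃ , d₄ , d₅ , d₆ , e₁ , e₂ , e₃) →
        ¬DBrev (v₀ , v₁ , v₂ , v₃ , d₁ , d₂ , d₃ , d₄ , d₅ , d₆ , lift e₁ , lift e₂ , lift e₃))
      where
      lift : ∀ {x y} → HasEdge G⁻ x y → HasEdge G x y
      lift = HasEdge⁻⇒HasEdge

    forest⁻ : IsForest G → IsForest G⁻
    forest⁻ forest l 1≤l C = forest l 1≤l record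
      { vs = vs ; es = suc ∘ es ; closed = closed ; vs-inj = vs-inj ; es-inj = es-inj ∘ suc-injective ; joins = joins }
      where open UndirCycle C

    walk⁻⇒walk : ∀ {x y} → Walk G⁻ x y → Walk G x y
    walk⁻⇒walk (nil x)      = nil x
    walk⁻⇒walk (cons i j W) = cons (suc i) j (walk⁻⇒walk W)

    zero∉walk⁻ : ∀ {x y} (W : Walk G⁻ x y) → ¬ (zero ∈ walkEdges G (walk⁻⇒walk W))
    zero∉walk⁻ (cons i j W) (there h) = zero∉walk⁻ W h

    forest⇒u≁v : IsForest G → ¬ Connected G⁻ u v
    forest⇒u≁v forest conn = zero∉walk⁻ W (forest-walk-uses-edge G forest (walk⁻⇒walk W) (inj₂ refl))
      where W = star⇒walk G⁻ conn

  edge-induction : (P : Digraph → Set) →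
    (∀ {nn} (edge : Fin 0 → Fin nn × Fin nn) (edge-inj : Injective _≡_ _≡_ edge) →
      P (record { n = nn ; m = 0 ; edge = edge ; edge-inj = edge-inj })) →
    (∀ {nn mm} (edge : Fin (suc mm) → Fin nn × Fin nn) (edge-inj : Injective _≡_ _≡_ edge) →
      P (FirstEdge.G⁻ edge edge-inj) → P (FirstEdge.G edge edge-inj)) →
    ∀ G → P G
  edge-induction P base step record { n = nn ; m = mm ; edge = edge ; edge-inj = edge-inj } = induct mm edge edge-inj
    where
    induct : ∀ mm (edge : Fin mm → Fin nn × Fin nn) (edge-inj : Injective _≡_ _≡_ edge) →
      P (record { n = nn ; m = mm ; edge = edge ; edge-inj = edge-inj })
    induct zero     edge edge-inj = base edge edge-inj
    induct (suc mm) edge edge-inj = step edge edge-inj (induct mm (edge ∘ suc) (suc-injective ∘ edge-inj))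

module Components where
  open EdgeDeletion
  open import Data.Nat using (ℕ; zero; suc)
  open import Data.Nat.Properties using (≤-antisym)
  open import Data.Fin using (Fin; zero; suc; punchOut; punchIn)
  open import Data.Fin.Properties using (_≟_; punchOut-injective; punchOut-cong; punchOut-punchIn; punchInᵢ≢i; injective⇒≤)
  open import Data.Product using (Σ; ∃; _×_; _,_; proj₁; proj₂)
  open import Data.Sum using (_⊎_; inj₁; inj₂)
  open import Function using (id; _∘_)
  open import Function.Bundles using (mk⇔; Equivalence)
  open import Function.Definitions using (Injective; Surjective)
  open import Relation.Nullary using (yes; no; contradiction)
  open import Relation.Binary.PropositionalEquality using (_≡_; _≢_; refl; sym; trans; cong; subst)
  open import Relation.Binary.Construct.Closure.ReflexiveTransitive using (ε; _◅_; _◅◅_; fold)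

  module _ (G : Digraph) {p : ℕ} (IC : IsNumComponents G p) where

    component : Fin (n G) → Fin p
    component = proj₁ IC

    same-component⇒connected : ∀ {x y} → component x ≡ component y → Connected G x y
    same-component⇒connected = Equivalence.to (proj₂ (proj₂ IC) _ _)

    connected⇒same-component : ∀ {x y} → Connected G x y → component x ≡ component y
    connected⇒same-component = Equivalence.from (proj₂ (proj₂ IC) _ _)

    representative : Fin p → Fin (n G)
    representative t = proj₁ (proj₁ (proj₂ IC) t)

    component-representative : ∀ t → component (representative t) ≡ t
    component-representative t = proj₂ (proj₁ (proj₂ IC) t) refl

    edge-same-component : ∀ i → component (src G i) ≡ component (tgt G i)
    edge-same-component i = connected⇒same-component (inj₁ (i , refl) ◅ ε)

  numComponents-unique : ∀ {G p q} → IsNumComponents G p → IsNumComponents G q → p ≡ q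
  numComponents-unique {G} ICp ICq = ≤-antisym (injective⇒≤ (compare ICp ICq)) (injective⇒≤ (compare ICq ICp))
    where
    compare : ∀ {p q} (ICp : IsNumComponents G p) (ICq : IsNumComponents G q) →
      Injective _≡_ _≡_ (λ t → component G ICq (representative G ICp t))
    compare ICp ICq {s} {t} e = trans (sym (component-representative G ICp s))
      (trans (connected⇒same-component G ICp (same-component⇒connected G ICq e)) (component-representative G ICp t))

  adjacent-invariant : ∀ G {A : Set} (f : Fin (n G) → A) → (∀ {x y} → Adj G x y → f x ≡ f y) →
    ∀ {x y} → Connected G x y → f x ≡ f y
  adjacent-invariant G f f-adj = fold (λ x y → f x ≡ f y) (λ a eq → trans (f-adj a) eq) refl

  module Collapse {q : ℕ} {i j : Fin (suc q)} (j≢i : j ≢ i) where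

    private
      redirect : Fin (suc q) → Fin (suc q)
      redirect t with j ≟ t
      ... | yes _ = i
      ... | no  _ = t

      j≢redirect : ∀ t → j ≢ redirect t
      j≢redirect t with j ≟ t
      ... | yes _   = j≢i
      ... | no  j≢t = j≢t

      redirect-j : redirect j ≡ i
      redirect-j with j ≟ j
      ... | yes _   = refl
      ... | no  j≢j = contradiction refl j≢j

      redirect-other : ∀ {t} → j ≢ t → redirect t ≡ t
      redirect-other {t} j≢t with j ≟ t
      ... | yes j≡t = contradiction j≡t j≢t
      ... | no  _   = refl

    collapse : Fin (suc q) → Fin q
    collapse t = punchOut (j≢redirect t)

    collapse-i≡j : collapse i ≡ collapse j
    collapse-i≡j = punchOut-cong j (trans (redirect-other j≢i) (sym redirect-j))

    collapse-punchIn : ∀ s → collapse (punchIn j s) ≡ s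
    collapse-punchIn s = trans (punchOut-cong j (redirect-other (punchInᵢ≢i j s ∘ sym))) (punchOut-punchIn j)

    collapse-≡ : ∀ {s t} → collapse s ≡ collapse t → s ≡ t ⊎ (s ≡ j × t ≡ i) ⊎ (s ≡ i × t ≡ j)
    collapse-≡ {s} {t} eq with punchOut-injective (j≢redirect s) (j≢redirect t) eq
    ... | e with j ≟ s | j ≟ t
    ...   | yes j≡s | yes j≡t = inj₁ (trans (sym j≡s) j≡t)
    ...   | yes j≡s | no  _   = inj₂ (inj₁ (sym j≡s , sym e))
    ...   | no  _   | yes j≡t = inj₂ (inj₂ (e , sym j≡t))
    ...   | no  _   | no  _   = inj₁ e

  module _ {nn mm : ℕ} (edge₀ : Fin (suc mm) → Fin nn × Fin nn) (edge₀-inj : Injective _≡_ _≡_ edge₀) where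

    open FirstEdge edge₀ edge₀-inj

    components-insert-internal : ∀ {p} (IC : IsNumComponents G⁻ p) → component G⁻ IC u ≡ component G⁻ IC v →
      IsNumComponents G p
    components-insert-internal {p} IC cu≡cv = c , proj₁ (proj₂ IC) , λ x y → mk⇔
      (λ cx≡cy → connected⁻⇒connected (same-component⇒connected G⁻ IC cx≡cy))
      (adjacent-invariant G c c-adj)
      where
      c : Fin nn → Fin p
      c = component G⁻ IC
      c-adj : ∀ {x y} → Adj G x y → c x ≡ c y
      c-adj a with Adj-cases a
      ... | inj₁ a⁻                   = connected⇒same-component G⁻ IC (a⁻ ◅ ε)
      ... | inj₂ (inj₁ (refl , refl)) = cu≡cv
      ... | inj₂ (inj₂ (refl , refl)) = sym cu≡cv

    components-insert-bridge : ∀ {q} (IC : IsNumComponents G⁻ (suc q)) → component G⁻ IC u ≢ component G⁻ IC v →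
      IsNumComponents G q
    components-insert-bridge {q} IC cu≢cv = c , c-surjective , λ x y → mk⇔ (c-connected x y) (adjacent-invariant G c c-adj)
      where
      c⁻ : Fin nn → Fin (suc q)
      c⁻ = component G⁻ IC
      open Collapse (cu≢cv ∘ sym)
      c : Fin nn → Fin q
      c = collapse ∘ c⁻
      c-adj : ∀ {x y} → Adj G x y → c x ≡ c y
      c-adj a with Adj-cases a
      ... | inj₁ a⁻                   = cong collapse (connected⇒same-component G⁻ IC (a⁻ ◅ ε))
      ... | inj₂ (inj₁ (refl , refl)) = collapse-i≡j
      ... | inj₂ (inj₂ (refl , refl)) = sym collapse-i≡j
      c-surjective : Surjective _≡_ _≡_ c
      c-surjective s = representative G⁻ IC (punchIn (c⁻ v) s) , λ { refl →
        trans (cong collapse (component-representative G⁻ IC _)) (collapse-punchIn s) }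
      connected⁻ : ∀ {x y} → c⁻ x ≡ c⁻ y → Connected G x y
      connected⁻ = connected⁻⇒connected ∘ same-component⇒connected G⁻ IC
      c-connected : ∀ x y → c x ≡ c y → Connected G x y
      c-connected x y cx≡cy with collapse-≡ cx≡cy
      ... | inj₁ e                  = connected⁻ e
      ... | inj₂ (inj₁ (x∼v , y∼u)) = connected⁻ x∼v ◅◅ (inj₂ (zero , refl) ◅ connected⁻ (sym y∼u))
      ... | inj₂ (inj₂ (x∼u , y∼v)) = connected⁻ x∼u ◅◅ (inj₁ (zero , refl) ◅ connected⁻ (sym y∼v))

    components-insert : ∃ (IsNumComponents G⁻) → ∃ (IsNumComponents G)
    components-insert (p , IC) with component G⁻ IC u ≟ component G⁻ IC v
    ... | yes cu≡cv = p , components-insert-internal IC cu≡cv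
    components-insert (zero  , IC) | no _ with component G⁻ IC u
    ... | ()
    components-insert (suc q , IC) | no cu≢cv = q , components-insert-bridge IC cu≢cv

  module _ {nn : ℕ} (edge : Fin 0 → Fin nn × Fin nn) (edge-inj : Injective _≡_ _≡_ edge) where

    private
      G : Digraph
      G = record { n = nn ; m = 0 ; edge = edge ; edge-inj = edge-inj }

    edgeless-components : IsNumComponents G nn
    edgeless-components = id , (λ y → y , λ { refl → refl }) , λ x y → mk⇔ (λ { refl → ε }) edgeless-connected
      where
      edgeless-connected : ∀ {x y} → Connected G x y → x ≡ y
      edgeless-connected ε                  = refl
      edgeless-connected (inj₁ (() , _) ◅ _)
      edgeless-connected (inj₂ (() , _) ◅ _)

  numComponents-exists : ∀ G → ∃ (IsNumComponents G)
  numComponents-exists = edge-induction (λ G → ∃ (IsNumComponents G)) (λ edge edge-inj → _ , edgeless-components edge edge-inj) components-insert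

  module _ {nn mm : ℕ} (edge₀ : Fin (suc mm) → Fin nn × Fin nn) (edge₀-inj : Injective _≡_ _≡_ edge₀) where

    open FirstEdge edge₀ edge₀-inj

    components-delete-bridge : ∀ {p} → IsForest G → IsNumComponents G p →
      Σ (IsNumComponents G⁻ (suc p)) λ IC⁻ → component G⁻ IC⁻ u ≢ component G⁻ IC⁻ v
    components-delete-bridge {p} forest IC with numComponents-exists G⁻
    ... | zero  , IC⁻ with component G⁻ IC⁻ u
    ...   | ()
    components-delete-bridge {p} forest IC | suc q , IC⁻ =
      subst (λ p′ → Σ (IsNumComponents G⁻ (suc p′)) λ IC⁻ → component G⁻ IC⁻ u ≢ component G⁻ IC⁻ v)
        (numComponents-unique {G} (components-insert-bridge edge₀ edge₀-inj IC⁻ u≁v) IC) (IC⁻ , u≁v)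
      where
      u≁v : component G⁻ IC⁻ u ≢ component G⁻ IC⁻ v
      u≁v = forest⇒u≁v forest ∘ same-component⇒connected G⁻ IC⁻

module ConsecutivePairs where
  open import Data.Bool using (Bool; true; false)
  open import Data.List using (List; []; _∷_; [_]; _++_; concat; concatMap; filter)
  open import Data.List.Properties using (++-assoc; concat-++; filter-++)
  open import Data.List.Membership.Propositional using (_∈_; find)
  open import Data.List.Membership.Propositional.Properties using (∈-++⁻; ∈-∃++; ∈-concat⁻)
  open import Data.List.Relation.Unary.Any using (here; there)
  open import Data.List.Relation.Unary.All using () renaming (lookup to All-lookup)
  open import Data.List.Relation.Unary.AllPairs using (_∷_)
  open import Data.List.Relation.Unary.Unique.Propositional using (Unique)
  open import Data.List.Relation.Binary.Permutation.Propositional using (_↭_; refl; prep; swap; trans)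
  open import Data.List.Relation.Binary.Permutation.Propositional.Properties using (++⁺ˡ; shifts; shift; map⁺)
  open import Data.Product using (∃; _×_; _,_; proj₁; proj₂)
  open import Data.Sum using (inj₁; inj₂)
  open import Data.Empty using (⊥-elim)
  open import Relation.Nullary using (does)
  open import Relation.Unary using (Decidable)
  open import Relation.Binary.PropositionalEquality using (_≡_; refl; sym; cong; cong₂)
  import Relation.Binary.PropositionalEquality as ≡

  concat-↭ : ∀ {A : Set} {xss yss : List (List A)} → xss ↭ yss → concat xss ↭ concat yss
  concat-↭ refl         = refl
  concat-↭ (prep xs p)  = ++⁺ˡ xs (concat-↭ p)
  concat-↭ (swap xs ys p) = trans (shifts xs ys) (++⁺ˡ ys (++⁺ˡ xs (concat-↭ p)))
  concat-↭ (trans p q)  = trans (concat-↭ p) (concat-↭ q)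

  ∈⇒↭∷ : ∀ {A : Set} {x : A} {xs} → x ∈ xs → ∃ λ ys → xs ↭ x ∷ ys
  ∈⇒↭∷ {x = x} x∈xs with ∈-∃++ x∈xs
  ... | ys , zs , refl = ys ++ zs , shift x ys zs

  module _ {V : Set} where

    consecs : List (List V) → List (V × V)
    consecs = concatMap consec

    consecs-↭ : ∀ {ps qs : List (List V)} → ps ↭ qs → consecs ps ↭ consecs qs
    consecs-↭ p = concat-↭ (map⁺ consec p)

    consec-fst : ∀ {x y} (L : List V) → (x , y) ∈ consec L → x ∈ L
    consec-fst (a ∷ b ∷ L) (here refl) = here refl
    consec-fst (a ∷ b ∷ L) (there h)   = there (consec-fst (b ∷ L) h)

    consec-snd : ∀ {x y} a (L : List V) → (x , y) ∈ consec (a ∷ L) → y ∈ L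
    consec-snd a (b ∷ L) (here refl) = here refl
    consec-snd a (b ∷ L) (there h)   = there (consec-snd b L h)

    consec-functional : ∀ {x y z} (L : List V) → Unique L → (x , y) ∈ consec L → (x , z) ∈ consec L → y ≡ z
    consec-functional (a ∷ b ∷ L) u         (here refl) (here refl) = refl
    consec-functional (a ∷ b ∷ L) (a∉ ∷ u)  (here refl) (there h)   = ⊥-elim (All-lookup a∉ (consec-fst (b ∷ L) h) refl)
    consec-functional (a ∷ b ∷ L) (a∉ ∷ u)  (there h)   (here refl) = ⊥-elim (All-lookup a∉ (consec-fst (b ∷ L) h) refl)
    consec-functional (a ∷ b ∷ L) (_ ∷ u)   (there h)   (there h′)  = consec-functional (b ∷ L) u h h′

    consec-injective : ∀ {x y z} (L : List V) → Unique L → (y , x) ∈ consec L → (z , x) ∈ consec L → y ≡ z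
    consec-injective (a ∷ b ∷ L) u              (here refl) (here refl) = refl
    consec-injective (a ∷ b ∷ L) (_ ∷ b∉ ∷ u)   (here refl) (there h)   = ⊥-elim (All-lookup b∉ (consec-snd b L h) refl)
    consec-injective (a ∷ b ∷ L) (_ ∷ b∉ ∷ u)   (there h)   (here refl) = ⊥-elim (All-lookup b∉ (consec-snd b L h) refl)
    consec-injective (a ∷ b ∷ L) (_ ∷ u)        (there h)   (there h′)  = consec-injective (b ∷ L) u h h′

    consec-++ˡ : ∀ {p} (A B : List V) → p ∈ consec A → p ∈ consec (A ++ B)
    consec-++ˡ (a ∷ b ∷ A) B (here refl) = here refl
    consec-++ˡ (a ∷ b ∷ A) B (there h)   = there (consec-++ˡ (b ∷ A) B h)

    consec-++ʳ : ∀ {p} (A B : List V) → p ∈ consec B → p ∈ consec (A ++ B)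
    consec-++ʳ []          B       h = h
    consec-++ʳ (a ∷ [])    (b ∷ B) h = there h
    consec-++ʳ (a ∷ a′ ∷ A) B      h = there (consec-++ʳ (a′ ∷ A) B h)

    consecs⊆consec-concat : ∀ {p} (ps : List (List V)) → p ∈ consecs ps → p ∈ consec (concat ps)
    consecs⊆consec-concat (L ∷ ps) h with ∈-++⁻ (consec L) h
    ... | inj₁ h′ = consec-++ˡ L (concat ps) h′
    ... | inj₂ h′ = consec-++ʳ L (concat ps) (consecs⊆consec-concat ps h′)

    consec-mid : ∀ (X : List V) a b Z → (a , b) ∈ consec (X ++ a ∷ b ∷ Z)
    consec-mid X a b Z = consec-++ʳ X (a ∷ b ∷ Z) (here refl)

    consec-join : ∀ (X : List V) s t Y → consec ((X ++ [ s ]) ++ t ∷ Y) ≡ consec (X ++ [ s ]) ++ (s , t) ∷ consec (t ∷ Y)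
    consec-join []           s t Y = refl
    consec-join (x ∷ [])     s t Y = refl
    consec-join (x ∷ x′ ∷ X) s t Y = cong ((x , x′) ∷_) (consec-join (x′ ∷ X) s t Y)

    consecs-++ : ∀ (ps qs : List (List V)) → consecs (ps ++ qs) ≡ consecs ps ++ consecs qs
    consecs-++ []       qs = refl
    consecs-++ (L ∷ ps) qs = ≡.trans (cong (consec L ++_) (consecs-++ ps qs)) (sym (++-assoc (consec L) _ _))

    module Cut {K : V × V → Set} (K? : Decidable K) where

      keep : List (V × V) → List (V × V)
      keep = filter {P = K} K?

      private
        attach : Bool → V → List V × List (List V) → List V × List (List V)
        attach true  y (P , Ps) = y ∷ P , Ps
        attach false y (P , Ps) = [] , (y ∷ P) ∷ Ps

        -- the rest of the piece that starts at x, and the pieces after it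
        rest : V → List V → List V × List (List V)
        rest x []       = [] , []
        rest x (y ∷ ys) = attach (does (K? (x , y))) y (rest y ys)

      cut : List V → List (List V)
      cut []       = []
      cut (x ∷ xs) = (x ∷ proj₁ (rest x xs)) ∷ proj₂ (rest x xs)

      private
        rest-concat : ∀ (x : V) (xs : List V) → x ∷ proj₁ (rest x xs) ++ concat (proj₂ (rest x xs)) ≡ x ∷ xs
        rest-concat x []       = refl
        rest-concat x (y ∷ ys) with does (K? (x , y)) | rest-concat y ys
        ... | true  | ih = cong (x ∷_) ih
        ... | false | ih = cong (x ∷_) ih

        rest-consecs : ∀ (x : V) (xs : List V) → consec (x ∷ proj₁ (rest x xs)) ++ consecs (proj₂ (rest x xs)) ≡ keep (consec (x ∷ xs))
        rest-consecs x []       = refl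
        rest-consecs x (y ∷ ys) with does (K? (x , y)) | rest-consecs y ys
        ... | true  | ih = cong ((x , y) ∷_) ih
        ... | false | ih = ih

      cut-concat : ∀ (L : List V) → concat (cut L) ≡ L
      cut-concat []       = refl
      cut-concat (x ∷ xs) = rest-concat x xs

      cut-consecs : ∀ (L : List V) → consecs (cut L) ≡ keep (consec L)
      cut-consecs []       = refl
      cut-consecs (x ∷ xs) = rest-consecs x xs

      cutAll : List (List V) → List (List V)
      cutAll = concatMap cut

      cutAll-concat : ∀ (ps : List (List V)) → concat (cutAll ps) ≡ concat ps
      cutAll-concat []       = refl
      cutAll-concat (L ∷ ps) = ≡.trans (sym (concat-++ (cut L) (cutAll ps))) (cong₂ _++_ (cut-concat L) (cutAll-concat ps))

      cutAll-consecs : ∀ (ps : List (List V)) → consecs (cutAll ps) ≡ keep (consecs ps)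
      cutAll-consecs []       = refl
      cutAll-consecs (L ∷ ps) = ≡.trans (consecs-++ (cut L) (cutAll ps))
        (≡.trans (cong₂ _++_ (cut-consecs L) (cutAll-consecs ps)) (sym (filter-++ K? (consec L) (consecs ps))))

  ∈-concat⇒↭ : ∀ {A : Set} {x : A} (xss : List (List A)) → x ∈ concat xss → ∃ λ xs → ∃ λ yss → xss ↭ xs ∷ yss × x ∈ xs
  ∈-concat⇒↭ xss x∈ with find (∈-concat⁻ xss x∈)
  ... | xs , xs∈xss , x∈xs = let (yss , p) = ∈⇒↭∷ xs∈xss in xs , yss , p , x∈xs

module Multipaths where
  open SubsetUpdates
  open ConsecutivePairs
  open ForestWalks
  open import Data.Fin using (Fin)
  import Data.Fin.Properties as Fin
  open import Data.Fin.Subset using (Subset; inside; _∈_; _∉_; _⊆_)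
  open import Data.Fin.Subset.Properties using (_∈?_)
  open import Data.Vec using (_[_]≔_)
  open import Data.List using (List; []; _∷_; [_]; _++_; concat; initLast; _∷ʳ′_)
  open import Data.List.Properties using (++-assoc)
  open import Data.List.Membership.Propositional using () renaming (_∈_ to _∈ₗ_; _∉_ to _∉ₗ_)
  open import Data.List.Membership.Propositional.Properties using (∈-filter⁺; ∈-filter⁻; ∈-++⁺ˡ; ∈-++⁺ʳ; ∈-++⁻; ∈-∃++)
  open import Data.List.Relation.Binary.Permutation.Propositional.Properties using (∈-resp-↭; shift)
  open import Data.List.Relation.Unary.Any using (here; there; toSum; fromSum)
  open import Data.List.Relation.Unary.All.Properties.Core using (¬Any⇒All¬)
  open import Data.List.Relation.Unary.AllPairs using (_∷_)
  open import Data.List.Relation.Unary.Unique.Propositional using (Unique)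
  open import Data.List.Relation.Binary.Permutation.Propositional using (_↭_; prep; ↭-sym; ↭⇒↭ₛ)
  open import Data.List.Relation.Binary.Permutation.Setoid.Properties using (Unique-resp-↭)
  open import Data.Product using (∃; _×_; _,_; proj₁; proj₂)
  open import Data.Sum as Sum using (_⊎_; inj₁; inj₂)
  open import Data.Empty using (⊥-elim)
  open import Data.Product.Properties using () renaming (≡-dec to ×-≡-dec)
  open import Function using (_∘_)
  open import Function.Bundles using (_⇔_; mk⇔; Equivalence)
  open import Relation.Nullary using (Dec; yes; no; _×-dec_)
  open import Relation.Binary.PropositionalEquality using (_≡_; _≢_; refl; sym; trans; cong; cong₂; subst; setoid)

  module _ (G : Digraph) where

    private
      V : Set
      V = Fin (n G)

    open import Data.List.Membership.DecPropositional (Fin._≟_ {n G}) using () renaming (_∈?_ to _∈?ₗ_)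

    EdgeIn : Subset (m G) → V × V → Set
    EdgeIn B x = ∃ λ i → i ∈ B × edge G i ≡ x

    EdgeIn? : ∀ B x → Dec (EdgeIn B x)
    EdgeIn? B x = Fin.any? λ i → (i ∈? B) ×-dec ×-≡-dec Fin._≟_ Fin._≟_ (edge G i) x

    -- Unlike in IsMultipath, every consecutive pair of ps must be an edge of B.
    record Realises (B : Subset (m G)) (ps : List (List V)) : Set where
      constructor realises
      field
        unique : Unique (concat ps)
        pairs  : ∀ x → x ∈ₗ consecs ps ⇔ EdgeIn B x

    realises⇒multipath : ∀ {B} ps → Realises B ps → IsMultipath G B
    realises⇒multipath {B} ps (realises u pairs) = ps , u , λ i → mk⇔
      (λ i∈B → Equivalence.from (pairs (edge G i)) (i , i∈B , refl))
      (λ e∈ps → let (j , j∈B , e) = Equivalence.to (pairs (edge G i)) e∈ps in subst (_∈ B) (edge-inj G e) j∈B)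

    realises-↭ : ∀ {B ps qs} → ps ↭ qs → Realises B ps → Realises B qs
    realises-↭ p (realises u pairs) = realises (Unique-resp-↭ (setoid V) (↭⇒↭ₛ (concat-↭ p)) u) λ x → mk⇔
      (λ x∈qs → Equivalence.to (pairs x) (∈-resp-↭ (consecs-↭ (↭-sym p)) x∈qs))
      (λ x∈B → ∈-resp-↭ (consecs-↭ p) (Equivalence.from (pairs x) x∈B))

    multipath-restrict : ∀ {B B′} → B′ ⊆ B → IsMultipath G B → ∃ (Realises B′)
    multipath-restrict {B} {B′} B′⊆B (ps , u , edges) =
      cutAll ps , realises (subst Unique (sym (cutAll-concat ps)) u) λ x → mk⇔
        (λ x∈cut → proj₂ (∈-filter⁻ (EdgeIn? B′) {xs = consecs ps} (subst (x ∈ₗ_) (cutAll-consecs ps) x∈cut)))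
        (λ x∈B′ → subst (x ∈ₗ_) (sym (cutAll-consecs ps)) (∈-filter⁺ (EdgeIn? B′) (in-ps x∈B′) x∈B′))
      where
      open Cut (EdgeIn? B′)
      in-ps : ∀ {x} → EdgeIn B′ x → x ∈ₗ consecs ps
      in-ps (i , i∈B′ , refl) = Equivalence.to (edges i) (B′⊆B i∈B′)

    multipath⇒realises : ∀ {B} → IsMultipath G B → ∃ (Realises B)
    multipath⇒realises = multipath-restrict (λ i∈B → i∈B)

    multipath-⊆ : ∀ {B B′} → B′ ⊆ B → IsMultipath G B → IsMultipath G B′
    multipath-⊆ B′⊆B mp = let (ps , r) = multipath-restrict B′⊆B mp in realises⇒multipath ps r

    multipath-src-injective : ∀ {B} → IsMultipath G B → ∀ {i j} → i ∈ B → j ∈ B → src G i ≡ src G j → i ≡ j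
    multipath-src-injective {B} (ps , u , edges) {i} {j} i∈B j∈B same-src =
      edge-inj G (cong₂ _,_ same-src (consec-functional (concat ps) u
        (subst (λ x → (x , tgt G i) ∈ₗ consec (concat ps)) same-src (on-path i∈B)) (on-path j∈B)))
      where
      on-path : ∀ {k} → k ∈ B → edge G k ∈ₗ consec (concat ps)
      on-path k∈B = consecs⊆consec-concat ps (Equivalence.to (edges _) k∈B)

    multipath-tgt-injective : ∀ {B} → IsMultipath G B → ∀ {i j} → i ∈ B → j ∈ B → tgt G i ≡ tgt G j → i ≡ j
    multipath-tgt-injective {B} (ps , u , edges) {i} {j} i∈B j∈B same-tgt =
      edge-inj G (cong₂ _,_ (consec-injective (concat ps) u
        (subst (λ y → (src G i , y) ∈ₗ consec (concat ps)) same-tgt (on-path i∈B)) (on-path j∈B)) same-tgt)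
      where
      on-path : ∀ {k} → k ∈ B → edge G k ∈ₗ consec (concat ps)
      on-path k∈B = consecs⊆consec-concat ps (Equivalence.to (edges _) k∈B)

    Chain : Subset (m G) → List V → Set
    Chain B L = ∀ {x} → x ∈ₗ consec L → EdgeIn B x

    realises-chain : ∀ {B L R} → Realises B (L ∷ R) → Chain B L
    realises-chain (realises _ pairs) x∈L = Equivalence.to (pairs _) (∈-++⁺ˡ x∈L)

    realises-cover : ∀ {B ps} → Realises B ps → ∀ x →
      ∃ λ qs → Realises B qs × x ∈ₗ concat qs × (∀ {y} → y ∈ₗ concat ps → y ∈ₗ concat qs)
    realises-cover {ps = ps} r@(realises u pairs) x with x ∈?ₗ concat ps
    ... | yes x∈ps = ps , r , x∈ps , λ y∈ps → y∈ps
    ... | no  x∉ps = [ x ] ∷ ps , realises (¬Any⇒All¬ _ x∉ps ∷ u) pairs , here refl , there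

    chain-last : ∀ {B L s} → Chain B L → s ∈ₗ L → (∀ {j} → j ∈ B → src G j ≢ s) → ∃ λ X → L ≡ X ++ [ s ]
    chain-last {s = s} chain s∈L s-free with ∈-∃++ s∈L
    ... | X , []    , refl = X , refl
    ... | X , y ∷ Y , refl = let (j , j∈B , e) = chain (consec-mid X s y Y) in ⊥-elim (s-free j∈B (cong proj₁ e))

    chain-head : ∀ {B L t} → Chain B L → t ∈ₗ L → (∀ {j} → j ∈ B → tgt G j ≢ t) → ∃ λ Y → L ≡ t ∷ Y
    chain-head {t = t} chain t∈L t-free with ∈-∃++ t∈L
    ... | X , Y , refl with initLast X
    ...   | []        = Y , refl
    ...   | X₀ ∷ʳ′ w = let (j , j∈B , e) = chain w→t in ⊥-elim (t-free j∈B (cong proj₂ e))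
      where
      w→t : (w , t) ∈ₗ consec ((X₀ ++ [ w ]) ++ t ∷ Y)
      w→t = subst ((w , t) ∈ₗ_) (sym (consec-join X₀ w t Y)) (∈-++⁺ʳ (consec (X₀ ++ [ w ])) (here refl))

    chain⇒walk : ∀ {B} a L b → Chain B (a ∷ L ++ [ b ]) → ∃ λ (W : Walk G a b) → ∀ {i} → i ∈ₗ walkEdges G W → i ∈ B
    chain⇒walk a []      b chain = let (i , i∈B , e) = chain (here refl) in
      cons i (inj₁ e) (nil b) , λ { (here refl) → i∈B }
    chain⇒walk a (x ∷ L) b chain with chain (here refl) | chain⇒walk x L b (chain ∘ there)
    ... | i , i∈B , e | W , W⊆B = cons i (inj₁ e) W , λ { (here refl) → i∈B ; (there i∈W) → W⊆B i∈W }

    EdgeIn-insert : ∀ {B c x} → EdgeIn (B [ c ]≔ inside) x ⇔ (x ≡ edge G c ⊎ EdgeIn B x)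
    EdgeIn-insert {B} {c} = mk⇔ to from
      where
      to : ∀ {x} → EdgeIn (B [ c ]≔ inside) x → x ≡ edge G c ⊎ EdgeIn B x
      to (i , i∈ , e) with ∈-[]≔inside⁻ B i∈
      ... | inj₁ i∈B = inj₂ (i , i∈B , e)
      ... | inj₂ refl = inj₁ (sym e)
      from : ∀ {x} → x ≡ edge G c ⊎ EdgeIn B x → EdgeIn (B [ c ]≔ inside) x
      from (inj₁ refl)           = c , ∈-[]≔inside⁺ B (inj₂ refl) , refl
      from (inj₂ (i , i∈B , e)) = i , ∈-[]≔inside⁺ B (inj₁ i∈B) , e

    realises-join : ∀ {B c X Y R} → Realises B ((X ++ [ src G c ]) ∷ (tgt G c ∷ Y) ∷ R) →
      Realises (B [ c ]≔ inside) (((X ++ [ src G c ]) ++ tgt G c ∷ Y) ∷ R)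
    realises-join {B} {c} {X} {Y} {R} (realises u pairs) =
      realises (subst Unique (sym (++-assoc (X ++ [ s ]) (t ∷ Y) (concat R))) u) λ x → mk⇔
        (λ x∈ → Equivalence.from EdgeIn-insert (Sum.map₂ (Equivalence.to (pairs x)) (toSum (∈-resp-↭ joined x∈))))
        (λ x∈ → ∈-resp-↭ (↭-sym joined) (fromSum (Sum.map₂ (Equivalence.from (pairs x)) (Equivalence.to EdgeIn-insert x∈))))
      where
      s t : Fin (n G)
      s = src G c
      t = tgt G c
      joined : consecs (((X ++ [ s ]) ++ t ∷ Y) ∷ R) ↭ (s , t) ∷ consecs ((X ++ [ s ]) ∷ (t ∷ Y) ∷ R)
      joined = subst (_↭ (s , t) ∷ consecs ((X ++ [ s ]) ∷ (t ∷ Y) ∷ R)) (sym (trans (cong (_++ consecs R) (consec-join X s t Y)) (++-assoc (consec (X ++ [ s ])) _ _)))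
        (shift (s , t) (consec (X ++ [ s ])) _)

    chain-avoids-target : IsForest G → ∀ {B c} X → c ∉ B → Chain B (X ++ [ src G c ]) → tgt G c ∉ₗ X ++ [ src G c ]
    chain-avoids-target forest {B} {c} X c∉B chain t∈ with ∈-++⁻ X t∈
    ... | inj₂ (here t≡s) = forest-loopless G forest c (cong (src G c ,_) t≡s)
    ... | inj₁ t∈X with ∈-∃++ t∈X
    ...   | X₁ , X₂ , refl = let (t→s , t→s⊆B) = chain⇒walk t X₂ s (chain ∘ suffix) in
      c∉B (t→s⊆B (forest-walk-uses-edge G forest t→s (inj₁ refl)))
      where
      s t : Fin (n G)
      s = src G c
      t = tgt G c
      suffix : ∀ {x} → x ∈ₗ consec (t ∷ X₂ ++ [ s ]) → x ∈ₗ consec ((X₁ ++ t ∷ X₂) ++ [ s ])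
      suffix x∈ = subst (_ ∈ₗ_) (cong consec (sym (++-assoc X₁ (t ∷ X₂) [ s ]))) (consec-++ʳ X₁ _ x∈)

    realises-chain₂ : ∀ {B L L′ R} → Realises B (L ∷ L′ ∷ R) → Chain B L′
    realises-chain₂ {L = L} (realises _ pairs) x∈L′ = Equivalence.to (pairs _) (∈-++⁺ʳ (consec L) (∈-++⁺ˡ x∈L′))

    realises-insert-before : ∀ {B c X R} → Realises B ((X ++ [ src G c ]) ∷ R) → tgt G c ∈ₗ concat R →
      (∀ {j} → j ∈ B → tgt G j ≢ tgt G c) → IsMultipath G (B [ c ]≔ inside)
    realises-insert-before {B} {c} {X} {R} r t∈R t-free with ∈-concat⇒↭ R t∈R
    ... | Lt , R′ , π , t∈Lt with chain-head (realises-chain₂ (realises-↭ (prep _ π) r)) t∈Lt t-free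
    ...   | Y , refl = realises⇒multipath (((X ++ [ src G c ]) ++ tgt G c ∷ Y) ∷ R′) (realises-join (realises-↭ (prep _ π) r))

    -- Once s = src c and t = tgt c occur on the paths, s must end its path (no edge of B leaves s) and t
    -- must start another one (no edge of B enters t, and t cannot come before s on a path since G is a
    -- forest); joining these two paths through c presents B + c.
    multipath-insert : IsForest G → ∀ {B c} → IsMultipath G B → c ∉ B →
      (∀ {j} → j ∈ B → src G j ≢ src G c) → (∀ {j} → j ∈ B → tgt G j ≢ tgt G c) →
      IsMultipath G (B [ c ]≔ inside)
    multipath-insert forest {B} {c} mp c∉B s-free t-free with multipath⇒realises mp
    ... | _ , r₀ with realises-cover r₀ (src G c)
    ... | _ , r₁ , s∈ps₁ , _ with realises-cover r₁ (tgt G c)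
    ... | ps₂ , r₂ , t∈ps₂ , ps₁⊆ps₂ with ∈-concat⇒↭ ps₂ (ps₁⊆ps₂ s∈ps₁)
    ... | Ls , R , π , s∈Ls with chain-last (realises-chain (realises-↭ π r₂)) s∈Ls s-free
    ... | X , refl with ∈-++⁻ (X ++ [ src G c ]) (∈-resp-↭ (concat-↭ π) t∈ps₂)
    ...   | inj₁ t∈Ls = ⊥-elim (chain-avoids-target forest X c∉B (realises-chain (realises-↭ π r₂)) t∈Ls)
    ...   | inj₂ t∈R  = realises-insert-before (realises-↭ π r₂) t∈R t-free

module Rank where
  open SubsetUpdates
  open Multipaths
  open import Data.Nat using (ℕ; suc; _≤_; s≤s)
  open import Data.Nat.Properties using (≤-antisym; ≤-trans)
  open import Data.Fin using (Fin)
  open import Data.Fin.Subset using (Subset; inside; outside; _∈_; _∉_; _⊆_; ∣_∣)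
  open import Data.Fin.Subset.Properties using (_∈?_; p⊆q⇒∣p∣≤∣q∣)
  open import Data.Vec using (_[_]≔_)
  open import Data.Product using (_×_; _,_; proj₁; proj₂)
  open import Data.Sum as Sum using (_⊎_; inj₁; inj₂)
  open import Function using (_∘_)
  open import Relation.Nullary using (yes; no; contradiction)
  open import Relation.Binary.PropositionalEquality using (_≡_; _≢_; refl; sym; trans; subst)

  module _ (G : Digraph) where

    SoleIn SoleOut : Fin (m G) → Set
    SoleIn  a = ∀ j → tgt G j ≡ tgt G a → j ≡ a
    SoleOut a = ∀ j → src G j ≡ src G a → j ≡ a

    SharedSource SharedTarget Parallel : Fin (m G) → Fin (m G) → Set
    SharedSource a b = src G a ≡ src G b × SoleIn a × SoleIn b
    SharedTarget a b = tgt G a ≡ tgt G b × SoleOut a × SoleOut b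
    Parallel a b = a ≢ b × (SharedSource a b ⊎ SharedTarget a b)

    Parallel-sym : ∀ {a b} → Parallel a b → Parallel b a
    Parallel-sym (a≢b , inj₁ (e , sa , sb)) = (λ b≡a → a≢b (sym b≡a)) , inj₁ (sym e , sb , sa)
    Parallel-sym (a≢b , inj₂ (e , sa , sb)) = (λ b≡a → a≢b (sym b≡a)) , inj₂ (sym e , sb , sa)

    parallel-exclusive : ∀ {a b B} → Parallel a b → IsMultipath G B → a ∈ B → b ∉ B
    parallel-exclusive (a≢b , inj₁ (e , _)) mp a∈B b∈B = a≢b (multipath-src-injective G mp a∈B b∈B e)
    parallel-exclusive (a≢b , inj₂ (e , _)) mp a∈B b∈B = a≢b (multipath-tgt-injective G mp a∈B b∈B e)

    multipath-exchange : IsForest G → ∀ {a b B} → Parallel a b → IsMultipath G B → a ∈ B →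
      IsMultipath G ((B [ a ]≔ outside) [ b ]≔ inside)
    multipath-exchange forest {a} {b} {B} par@(_ , kind) mp a∈B =
      multipath-insert G forest (multipath-⊆ G (proj₁ ∘ ∈-[]≔outside⁻ B) mp)
        (λ b∈ → parallel-exclusive par mp a∈B (proj₁ (∈-[]≔outside⁻ B b∈))) (src-free kind) (tgt-free kind)
      where
      src-free : SharedSource a b ⊎ SharedTarget a b → ∀ {j} → j ∈ B [ a ]≔ outside → src G j ≢ src G b
      src-free (inj₁ (e , _ , _))  {j} j∈ s≡ = let (j∈B , j≢a) = ∈-[]≔outside⁻ B j∈ in
        j≢a (multipath-src-injective G mp j∈B a∈B (trans s≡ (sym e)))
      src-free (inj₂ (_ , _ , sole-b)) {j} j∈ s≡ = parallel-exclusive par mp a∈B (subst (_∈ B) (sole-b j s≡) (proj₁ (∈-[]≔outside⁻ B j∈)))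
      tgt-free : SharedSource a b ⊎ SharedTarget a b → ∀ {j} → j ∈ B [ a ]≔ outside → tgt G j ≢ tgt G b
      tgt-free (inj₁ (_ , _ , sole-b)) {j} j∈ t≡ = parallel-exclusive par mp a∈B (subst (_∈ B) (sole-b j t≡) (proj₁ (∈-[]≔outside⁻ B j∈)))
      tgt-free (inj₂ (e , _ , _))  {j} j∈ t≡ = let (j∈B , j≢a) = ∈-[]≔outside⁻ B j∈ in
        j≢a (multipath-tgt-injective G mp j∈B a∈B (trans t≡ (sym e)))

  module _ (G : Digraph) (r : Subset (m G) → ℕ) (rank : IsRankFunction G r) where

    rank-bound : ∀ {A B} → B ⊆ A → IsMultipath G B → ∣ B ∣ ≤ r A
    rank-bound {A} {B} = proj₂ (rank A) B

    rank-mono : ∀ {A A′} → A ⊆ A′ → r A ≤ r A′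
    rank-mono {A} A⊆A′ with proj₁ (rank A)
    ... | B , B⊆A , mp , ∣B∣≡rA = subst (_≤ r _) ∣B∣≡rA (rank-bound (A⊆A′ ∘ B⊆A) mp)

    rank≤size : ∀ A → r A ≤ ∣ A ∣
    rank≤size A with proj₁ (rank A)
    ... | B , B⊆A , _ , ∣B∣≡rA = subst (_≤ ∣ A ∣) ∣B∣≡rA (p⊆q⇒∣p∣≤∣q∣ B⊆A)

    rank-insert-≤ : ∀ A c → r (A [ c ]≔ inside) ≤ suc (r A)
    rank-insert-≤ A c with proj₁ (rank (A [ c ]≔ inside))
    ... | B , B⊆A+c , mp , ∣B∣≡r = subst (_≤ suc (r A)) ∣B∣≡r
      (≤-trans (∣A∣≤1+∣remove∣ B c) (s≤s (rank-bound B-c⊆A (multipath-⊆ G (proj₁ ∘ ∈-[]≔outside⁻ B) mp))))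
      where
      B-c⊆A : B [ c ]≔ outside ⊆ A
      B-c⊆A j∈ with ∈-[]≔outside⁻ B j∈
      ... | j∈B , j≢c with ∈-[]≔inside⁻ A (B⊆A+c j∈B)
      ...   | inj₁ j∈A = j∈A
      ...   | inj₂ j≡c = contradiction j≡c j≢c

    rank-insert-free : IsForest G → ∀ {A c} → c ∉ A →
      (∀ {j} → j ≢ c → src G j ≢ src G c) → (∀ {j} → j ≢ c → tgt G j ≢ tgt G c) →
      r (A [ c ]≔ inside) ≡ suc (r A)
    rank-insert-free forest {A} {c} c∉A src-free tgt-free = ≤-antisym (rank-insert-≤ A c) rank-A<rank-A+c
      where
      rank-A<rank-A+c : suc (r A) ≤ r (A [ c ]≔ inside)
      rank-A<rank-A+c with proj₁ (rank A)
      ... | B , B⊆A , mp , ∣B∣≡rA = subst (λ k → suc k ≤ r (A [ c ]≔ inside)) ∣B∣≡rA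
        (subst (_≤ r (A [ c ]≔ inside)) (∣insert∣ B (c∉A ∘ B⊆A))
        (rank-bound (∈-[]≔inside⁺ A ∘ Sum.map₁ B⊆A ∘ ∈-[]≔inside⁻ B)
          (multipath-insert G forest mp (c∉A ∘ B⊆A) (src-free ∘ ≢c) (tgt-free ∘ ≢c))))
        where
        ≢c : ∀ {j} → j ∈ B → j ≢ c
        ≢c j∈B refl = c∉A (B⊆A j∈B)

    rank-insert-parallel : IsForest G → ∀ {A a b} → Parallel G a b → b ∈ A → r (A [ a ]≔ inside) ≡ r A
    rank-insert-parallel forest {A} {a} {b} par@(a≢b , _) b∈A =
      ≤-antisym rank-A+a≤rank-A (rank-mono (∈-[]≔inside⁺ A ∘ inj₁))
      where
      rank-A+a≤rank-A : r (A [ a ]≔ inside) ≤ r A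
      rank-A+a≤rank-A with proj₁ (rank (A [ a ]≔ inside))
      ... | B , B⊆A+a , mp , ∣B∣≡r with a ∈? B
      ...   | no a∉B = subst (_≤ r A) ∣B∣≡r (rank-bound B⊆A mp)
        where
        B⊆A : B ⊆ A
        B⊆A j∈B with ∈-[]≔inside⁻ A (B⊆A+a j∈B)
        ... | inj₁ j∈A = j∈A
        ... | inj₂ refl = contradiction j∈B a∉B
      ...   | yes a∈B = subst (_≤ r A) (trans same-size ∣B∣≡r)
        (rank-bound B′⊆A (multipath-exchange G forest par mp a∈B))
        where
        B′ : Subset (m G)
        B′ = (B [ a ]≔ outside) [ b ]≔ inside
        same-size : ∣ B′ ∣ ≡ ∣ B ∣
        same-size = trans (∣insert∣ (B [ a ]≔ outside) (parallel-exclusive G par mp a∈B ∘ proj₁ ∘ ∈-[]≔outside⁻ B))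
          (sym (∣remove∣ B a∈B))
        B′⊆A : B′ ⊆ A
        B′⊆A j∈ with ∈-[]≔inside⁻ (B [ a ]≔ outside) j∈
        ... | inj₂ refl = b∈A
        ... | inj₁ j∈B-a with ∈-[]≔outside⁻ B j∈B-a
        ...   | j∈B , j≢a with ∈-[]≔inside⁻ A (B⊆A+a j∈B)
        ...     | inj₁ j∈A = j∈A
        ...     | inj₂ j≡a = contradiction j≡a j≢a

module ParallelEdges where
  open ForestWalks
  open Rank
  open import Data.Fin.Properties using (_≟_)
  open import Data.Product using (_,_; proj₁; proj₂)
  open import Data.Sum using (inj₁; inj₂)
  open import Relation.Nullary using (¬_; yes; no; contradiction)
  open import Relation.Binary.PropositionalEquality using (_≡_; _≢_; refl; sym; trans; cong; cong₂)

  module _ (G : Digraph) (mp1 : MP1 G) (forest : IsForest G) where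

    private
      ¬DA : ¬ ContainsDA G
      ¬DA = proj₁ mp1
      ¬DB : ¬ ContainsDB G
      ¬DB = proj₁ (proj₂ (proj₂ mp1))
      ¬DBrev : ¬ ContainsDBrev G
      ¬DBrev = proj₂ (proj₂ (proj₂ mp1))

      loopless : ∀ i → src G i ≢ tgt G i
      loopless i e = forest-loopless G forest i (cong (src G i ,_) (sym e))

      same-ends : ∀ {i j} → src G i ≡ src G j → tgt G i ≡ tgt G j → i ≡ j
      same-ends s≡ t≡ = edge-inj G (cong₂ _,_ s≡ t≡)

    -- Another edge j into tgt a forms D_B with a and b, or D_A with them if src j = tgt b.
    shared-source⇒SoleIn : ∀ {a b} → a ≢ b → src G a ≡ src G b → SoleIn G a
    shared-source⇒SoleIn {a} {b} a≢b sa≡sb j tj≡ta with j ≟ a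
    ... | yes j≡a = j≡a
    ... | no  j≢a = contradiction
      ( src G j , tgt G a , src G a , tgt G b
      , (λ e → loopless j (trans e (sym tj≡ta))) , (λ e → j≢a (same-ends e tj≡ta)) , sj≢tb
      , (λ e → loopless a (sym e)) , (λ e → a≢b (same-ends sa≡sb e)) , (λ e → loopless b (trans (sym sa≡sb) e))
      , (j , cong (src G j ,_) tj≡ta) , (a , refl) , (b , cong (_, tgt G b) (sym sa≡sb)) ) ¬DB
      where
      sj≢tb : src G j ≢ tgt G b
      sj≢tb e = ¬DA
        ( tgt G b , src G a , tgt G a
        , (λ e′ → loopless b (sym (trans e′ sa≡sb))) , (λ e′ → a≢b (same-ends sa≡sb (sym e′))) , loopless a
        , (b , cong (_, tgt G b) (sym sa≡sb)) , (j , cong₂ _,_ e tj≡ta) , (a , refl) )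

    shared-target⇒SoleOut : ∀ {a b} → a ≢ b → tgt G a ≡ tgt G b → SoleOut G a
    shared-target⇒SoleOut {a} {b} a≢b ta≡tb j sj≡sa with j ≟ a
    ... | yes j≡a = j≡a
    ... | no  j≢a = contradiction
      ( tgt G j , src G a , tgt G a , src G b
      , (λ e → loopless j (trans sj≡sa (sym e))) , (λ e → j≢a (same-ends sj≡sa e)) , tj≢sb
      , loopless a , (λ e → a≢b (same-ends e ta≡tb)) , (λ e → loopless b (trans (sym e) ta≡tb))
      , (j , cong (_, tgt G j) sj≡sa) , (a , refl) , (b , cong (src G b ,_) (sym ta≡tb)) ) ¬DBrev
      where
      tj≢sb : tgt G j ≢ src G b
      tj≢sb e = ¬DA
        ( src G b , src G a , tgt G a
        , (λ e′ → a≢b (same-ends (sym e′) ta≡tb)) , (λ e′ → loopless b (trans e′ ta≡tb)) , loopless a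
        , (j , cong₂ _,_ sj≡sa e) , (b , cong (src G b ,_) (sym ta≡tb)) , (a , refl) )

    shared-source⇒parallel : ∀ {a b} → a ≢ b → src G a ≡ src G b → Parallel G a b
    shared-source⇒parallel a≢b e =
      a≢b , inj₁ (e , shared-source⇒SoleIn a≢b e , shared-source⇒SoleIn (λ b≡a → a≢b (sym b≡a)) (sym e))

    shared-target⇒parallel : ∀ {a b} → a ≢ b → tgt G a ≡ tgt G b → Parallel G a b
    shared-target⇒parallel a≢b e =
      a≢b , inj₂ (e , shared-target⇒SoleOut a≢b e , shared-target⇒SoleOut (λ b≡a → a≢b (sym b≡a)) (sym e))

module TutteSums where
  open SubsetUpdates
  open import Data.Nat using (ℕ; zero; suc; _≤_; _∸_)
  open import Data.Nat.Properties using (+-∸-assoc)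
  open import Data.Integer using (ℤ; +_; _+_; _-_; _*_; _^_; -_; 0ℤ; -1ℤ)
  open import Data.Integer.Properties using (+-comm; +-identityʳ; neg-involutive; neg-distrib-+; *-distribˡ-+; *-assoc; -1*i≡-i; neg-distribʳ-*)
  open import Data.Integer.Solver using (module +-*-Solver)
  open +-*-Solver using (solve; _:+_; _:*_; _:-_; _:=_; con)
  open import Data.Bool using (not)
  open import Data.Fin using (Fin; zero; suc)
  open import Data.Fin.Subset using (Subset; inside; outside; ⊤; ∣_∣; _∉_)
  open import Data.Fin.Subset.Properties using (_∈?_)
  open import Data.Vec using ([]; _∷_; _[_]≔_; _[_]%=_)
  open import Function using (_∘_)
  open import Relation.Nullary using (yes; no)
  open import Relation.Binary.PropositionalEquality using (_≡_; refl; sym; trans; cong; cong₂; subst)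
  open Relation.Binary.PropositionalEquality.≡-Reasoning

  private
    variable
      k : ℕ

  sumSubsets-cong : ∀ k {f g : Subset k → ℤ} → (∀ A → f A ≡ g A) → sumSubsets k f ≡ sumSubsets k g
  sumSubsets-cong zero    f≗g = f≗g []
  sumSubsets-cong (suc k) f≗g = cong₂ _+_ (sumSubsets-cong k (f≗g ∘ (outside ∷_))) (sumSubsets-cong k (f≗g ∘ (inside ∷_)))

  sumSubsets-toggle : ∀ k (i : Fin k) (g : Subset k → ℤ) → sumSubsets k g ≡ sumSubsets k (λ A → g (A [ i ]%= not))
  sumSubsets-toggle (suc k) zero    g = +-comm (sumSubsets k (g ∘ (outside ∷_))) (sumSubsets k (g ∘ (inside ∷_)))
  sumSubsets-toggle (suc k) (suc i) g =
    cong₂ _+_ (sumSubsets-toggle k i (g ∘ (outside ∷_))) (sumSubsets-toggle k i (g ∘ (inside ∷_)))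

  sumSubsets-neg : ∀ k (g : Subset k → ℤ) → sumSubsets k (λ A → - g A) ≡ - sumSubsets k g
  sumSubsets-neg zero    g = refl
  sumSubsets-neg (suc k) g = trans (cong₂ _+_ (sumSubsets-neg k (g ∘ (outside ∷_))) (sumSubsets-neg k (g ∘ (inside ∷_))))
    (sym (neg-distrib-+ (sumSubsets k (g ∘ (outside ∷_))) (sumSubsets k (g ∘ (inside ∷_)))))

  sumSubsets-*ˡ : ∀ k c (g : Subset k → ℤ) → sumSubsets k (λ A → c * g A) ≡ c * sumSubsets k g
  sumSubsets-*ˡ zero    c g = refl
  sumSubsets-*ˡ (suc k) c g = trans (cong₂ _+_ (sumSubsets-*ˡ k c (g ∘ (outside ∷_))) (sumSubsets-*ˡ k c (g ∘ (inside ∷_))))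
    (sym (*-distribˡ-+ c _ _))

  i≡-i⇒i≡0 : ∀ {i : ℤ} → i ≡ - i → i ≡ 0ℤ
  i≡-i⇒i≡0 {+ zero} _ = refl

  sumSubsets-antisymmetric : ∀ k (i : Fin k) (g : Subset k → ℤ) → (∀ A → i ∉ A → g (A [ i ]%= not) ≡ - g A) →
    sumSubsets k g ≡ 0ℤ
  sumSubsets-antisymmetric k i g flip = i≡-i⇒i≡0 (begin
    sumSubsets k g                        ≡⟨ sumSubsets-toggle k i g ⟩
    sumSubsets k (λ A → g (A [ i ]%= not)) ≡⟨ sumSubsets-cong k flip′ ⟩
    sumSubsets k (λ A → - g A)            ≡⟨ sumSubsets-neg k g ⟩
    - sumSubsets k g                      ∎)
    where
    flip′ : ∀ A → g (A [ i ]%= not) ≡ - g A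
    flip′ A with i ∈? A
    ... | no  i∉A = flip A i∉A
    ... | yes i∈A = begin
      g (A [ i ]%= not)                    ≡⟨ neg-involutive _ ⟨
      - - g (A [ i ]%= not)                ≡⟨ cong -_ (subst (λ B → g B ≡ - g (A [ i ]%= not)) ([]%=not-involutive A i) (flip (A [ i ]%= not) (∈⇒∉[]%=not A i∈A))) ⟨
      - g A                                ∎

  tutteTerm : (Subset k → ℕ) → ℤ → ℤ → Subset k → ℤ
  tutteTerm r x y A = (x - + 1) ^ (r ⊤ ∸ r A) * (y - + 1) ^ (∣ A ∣ ∸ r A)

  tutte : (Subset k → ℕ) → ℤ → ℤ → ℤ
  tutte {k} r x y = sumSubsets k (tutteTerm r x y)

  module _ {k : ℕ} (r : Subset (suc k) → ℕ) (x : ℤ) where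

    private
      r⁻ : Subset k → ℕ
      r⁻ A = r (outside ∷ A)

    -- The inequalities assumed here and in tutte-parallel make the truncated subtractions in tutteTerm exact.
    tutte-coloop : (∀ A → r (inside ∷ A) ≡ suc (r (outside ∷ A))) → (∀ A → r (outside ∷ A) ≤ r (outside ∷ ⊤)) →
      tutte r x 0ℤ ≡ x * tutte r⁻ x 0ℤ
    tutte-coloop r-coloop r⁻-mono = begin
      sumSubsets k (λ A → tutteTerm r x 0ℤ (outside ∷ A)) + sumSubsets k (λ A → tutteTerm r x 0ℤ (inside ∷ A))
        ≡⟨ cong₂ _+_ (sumSubsets-cong k without) (sumSubsets-cong k with′) ⟩
      sumSubsets k (λ A → (x - + 1) * tutteTerm r⁻ x 0ℤ A) + T⁻
        ≡⟨ cong (_+ T⁻) (sumSubsets-*ˡ k (x - + 1) (tutteTerm r⁻ x 0ℤ)) ⟩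
      (x - + 1) * T⁻ + T⁻
        ≡⟨ solve 2 (λ x t → (x :- con (+ 1)) :* t :+ t := x :* t) refl x T⁻ ⟩
      x * T⁻ ∎
      where
      T⁻ : ℤ
      T⁻ = tutte r⁻ x 0ℤ
      without : ∀ A → tutteTerm r x 0ℤ (outside ∷ A) ≡ (x - + 1) * tutteTerm r⁻ x 0ℤ A
      without A rewrite r-coloop ⊤ | +-∸-assoc 1 (r⁻-mono A) = *-assoc (x - + 1) _ _
      with′ : ∀ A → tutteTerm r x 0ℤ (inside ∷ A) ≡ tutteTerm r⁻ x 0ℤ A
      with′ A rewrite r-coloop ⊤ | r-coloop A = refl

    tutte-parallel : ∀ i → r (inside ∷ ⊤) ≡ r (outside ∷ ⊤) →
      (∀ A → i ∉ A → r (inside ∷ A [ i ]≔ inside) ≡ r (inside ∷ A)) → (∀ A → r A ≤ ∣ A ∣) →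
      tutte r x 0ℤ ≡ tutte r⁻ x 0ℤ
    tutte-parallel i r-⊤ r-parallel r≤size = begin
      sumSubsets k (λ A → tutteTerm r x 0ℤ (outside ∷ A)) + sumSubsets k with′
        ≡⟨ cong₂ _+_ (sumSubsets-cong k without) (sumSubsets-antisymmetric k i with′ flip) ⟩
      tutte r⁻ x 0ℤ + 0ℤ
        ≡⟨ +-identityʳ _ ⟩
      tutte r⁻ x 0ℤ ∎
      where
      without : ∀ A → tutteTerm r x 0ℤ (outside ∷ A) ≡ tutteTerm r⁻ x 0ℤ A
      without A rewrite r-⊤ = refl
      with′ : Subset k → ℤ
      with′ A = tutteTerm r x 0ℤ (inside ∷ A)
      flip : ∀ A → i ∉ A → with′ (A [ i ]%= not) ≡ - with′ A
      flip A i∉A rewrite []%=not-∉ A i∉A | r-parallel A i∉A | ∣insert∣ A i∉A | +-∸-assoc 1 (r≤size (inside ∷ A)) =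
        *-negate-right ((x - + 1) ^ (r ⊤ ∸ r (inside ∷ A))) ((0ℤ - + 1) ^ (suc ∣ A ∣ ∸ r (inside ∷ A)))
        where
        *-negate-right : ∀ a b → a * (-1ℤ * b) ≡ - (a * b)
        *-negate-right a b = trans (cong (a *_) (-1*i≡-i b)) (sym (neg-distribʳ-* a b))

module Recolouring where
  open Counting
  open FlowingColourings
  open Components
  open import Data.Nat using (ℕ; _*_)
  open import Data.Nat.Properties using (+-0-commutativeMonoid)
  open import Algebra.Properties.CommutativeMonoid.Sum +-0-commutativeMonoid using (sum-syntax; sum-cong-≗)
  open import Data.Bool using (Bool; _∧_)
  open import Data.Fin using (Fin)
  open import Data.Fin.Properties using (_≟_)
  open import Data.Fin.Permutation using (Permutation; transpose; _⟨$⟩ʳ_; _⟨$⟩ˡ_; inverseˡ; inverseʳ)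
  open import Data.Vec using (Vec; lookup; tabulate)
  open import Data.Vec.Properties using (lookup∘tabulate; tabulate∘lookup; tabulate-cong)
  open import Function using (_∘_)
  open import Function.Bundles using (_⇔_; mk⇔; Equivalence; Injection)
  open import Function.Properties.Inverse using (↔⇒↣)
  open import Relation.Nullary using (yes; no; contradiction)
  open import Relation.Nullary.Decidable using (dec-true)
  open import Relation.Binary.PropositionalEquality using (_≡_; _≢_; refl; sym; trans; cong; cong₂)
  open Relation.Binary.PropositionalEquality.≡-Reasoning

  module _ (H : Digraph) {p : ℕ} (IC : IsNumComponents H p) {k : ℕ} where

    private
      comp : Fin (n H) → Fin p
      comp = component H IC

    flowing-transfer : (c c′ : Fin (n H) → Fin k) →
      (∀ {x y} → comp x ≡ comp y → c x ≡ c y → c′ x ≡ c′ y) → (∀ {x y} → comp x ≡ comp y → c′ x ≡ c′ y → c x ≡ c y) →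
      Flowing H c → Flowing H c′
    flowing-transfer c c′ to from flowing = record
      { proper        = λ i → proper i ∘ from (edge-same-component H IC i)
      ; sources-agree = λ i j e → to (same-src i j e) (sources-agree i j e)
      ; targets-agree = λ i j e → to (same-tgt i j e) (targets-agree i j e)
      }
      where
      open Flowing flowing
      same-src : ∀ i j → tgt H i ≡ tgt H j → comp (src H i) ≡ comp (src H j)
      same-src i j e = trans (edge-same-component H IC i) (trans (cong comp e) (sym (edge-same-component H IC j)))
      same-tgt : ∀ i j → src H i ≡ src H j → comp (tgt H i) ≡ comp (tgt H j)
      same-tgt i j e = trans (sym (edge-same-component H IC i)) (trans (cong comp e) (edge-same-component H IC j))

    isFlowing-transfer : (c c′ : Fin (n H) → Fin k) → (∀ {x y} → comp x ≡ comp y → (c x ≡ c y) ⇔ (c′ x ≡ c′ y)) →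
      isFlowing H c ≡ isFlowing H c′
    isFlowing-transfer c c′ c⇔c′ = T-injective
      (Equivalence.from (isFlowing⇔Flowing H c′) ∘ flowing-transfer c c′ (Equivalence.to ∘ c⇔c′) (Equivalence.from ∘ c⇔c′)
        ∘ Equivalence.to (isFlowing⇔Flowing H c))
      (Equivalence.from (isFlowing⇔Flowing H c) ∘ flowing-transfer c′ c (Equivalence.from ∘ c⇔c′) (Equivalence.to ∘ c⇔c′)
        ∘ Equivalence.to (isFlowing⇔Flowing H c′))

    module _ (b : Fin (n H)) where

      recolour : (Fin k → Fin k) → (Fin (n H) → Fin k) → Fin (n H) → Fin k
      recolour f c x with comp x ≟ comp b
      ... | yes _ = f (c x)
      ... | no  _ = c x

      recolour-inside : ∀ f c {x} → comp x ≡ comp b → recolour f c x ≡ f (c x)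
      recolour-inside f c {x} x∼b with comp x ≟ comp b
      ... | yes _   = refl
      ... | no  x≁b = contradiction x∼b x≁b

      recolour-outside : ∀ f c {x} → comp x ≢ comp b → recolour f c x ≡ c x
      recolour-outside f c {x} x≁b with comp x ≟ comp b
      ... | yes x∼b = contradiction x∼b x≁b
      ... | no  _   = refl

      recolour-≗ : ∀ f {c c′} → (∀ y → c y ≡ c′ y) → ∀ x → recolour f c x ≡ recolour f c′ x
      recolour-≗ f c≗c′ x with comp x ≟ comp b
      ... | yes _ = cong f (c≗c′ x)
      ... | no  _ = c≗c′ x

      recolour-inverse : ∀ f g → (∀ i → g (f i) ≡ i) → ∀ c x → recolour g (recolour f c) x ≡ c x
      recolour-inverse f g gf≗id c x with comp x ≟ comp b
      ... | yes x∼b = trans (cong g (recolour-inside f c x∼b)) (gf≗id (c x))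
      ... | no  x≁b = recolour-outside f c x≁b

      recolour-≡ : ∀ f → (∀ {i j} → f i ≡ f j → i ≡ j) → ∀ c {x y} → comp x ≡ comp y →
        recolour f c x ≡ recolour f c y → c x ≡ c y
      recolour-≡ f f-inj c {x} {y} x∼y with comp x ≟ comp b
      ... | yes x∼b = λ e → f-inj (trans e (recolour-inside f c (trans (sym x∼y) x∼b)))
      ... | no  x≁b = λ e → trans e (recolour-outside f c (λ y∼b → x≁b (trans x∼y y∼b)))

      recolour-cong : ∀ f c {x y} → comp x ≡ comp y → c x ≡ c y → recolour f c x ≡ recolour f c y
      recolour-cong f c {x} {y} x∼y cx≡cy with comp x ≟ comp b
      ... | yes x∼b = trans (cong f cx≡cy) (sym (recolour-inside f c (trans (sym x∼y) x∼b)))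
      ... | no  x≁b = trans cx≡cy (sym (recolour-outside f c (λ y∼b → x≁b (trans x∼y y∼b))))

      module _ (a : Fin (n H)) (a≁b : comp a ≢ comp b) where

        private
          Colouring : Set
          Colouring = Vec (Fin k) (n H)

          flowing : Colouring → Bool
          flowing v = isFlowing H (lookup v)

          recolourBy : (Fin k → Fin k → Fin k) → Colouring → Colouring
          recolourBy f v = tabulate (recolour (f (lookup v a)) (lookup v))

          recolourBy-a : ∀ f v → lookup (recolourBy f v) a ≡ lookup v a
          recolourBy-a f v = trans (lookup∘tabulate _ a) (recolour-outside _ (lookup v) a≁b)

          recolourBy-inverse : ∀ f g → (∀ s i → g s (f s i) ≡ i) → ∀ v → recolourBy g (recolourBy f v) ≡ v
          recolourBy-inverse f g gf≗id v = trans (tabulate-cong pointwise) (tabulate∘lookup v)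
            where
            pointwise : ∀ x → recolour (g (lookup (recolourBy f v) a)) (lookup (recolourBy f v)) x ≡ lookup v x
            pointwise x = begin
              recolour (g (lookup (recolourBy f v) a)) (lookup (recolourBy f v)) x
                ≡⟨ cong (λ s → recolour (g s) (lookup (recolourBy f v)) x) (recolourBy-a f v) ⟩
              recolour (g (lookup v a)) (lookup (recolourBy f v)) x
                ≡⟨ recolour-≗ (g (lookup v a)) (lookup∘tabulate _) x ⟩
              recolour (g (lookup v a)) (recolour (f (lookup v a)) (lookup v)) x
                ≡⟨ recolour-inverse (f (lookup v a)) (g (lookup v a)) (gf≗id (lookup v a)) (lookup v) x ⟩
              lookup v x ∎

          σ : Fin k → Colouring → Permutation k k
          σ t v = transpose t (lookup v a)

          shift unshift : Fin k → Colouring → Colouring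
          shift   t = recolourBy λ s → transpose t s ⟨$⟩ʳ_
          unshift t = recolourBy λ s → transpose t s ⟨$⟩ˡ_

          unshift-shift : ∀ t v → unshift t (shift t v) ≡ v
          unshift-shift t = recolourBy-inverse (λ s → transpose t s ⟨$⟩ʳ_) (λ s → transpose t s ⟨$⟩ˡ_) λ s _ → inverseˡ (transpose t s)

          shift-unshift : ∀ t v → shift t (unshift t v) ≡ v
          shift-unshift t = recolourBy-inverse (λ s → transpose t s ⟨$⟩ˡ_) (λ s → transpose t s ⟨$⟩ʳ_) λ s _ → inverseʳ (transpose t s)

          σ-injective : ∀ t v {i j} → σ t v ⟨$⟩ʳ i ≡ σ t v ⟨$⟩ʳ j → i ≡ j
          σ-injective t v = Injection.injective (↔⇒↣ (σ t v))

          σ-sends : ∀ t v → σ t v ⟨$⟩ʳ t ≡ lookup v a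
          σ-sends t v rewrite dec-true (t ≟ t) refl = refl

          shift-flowing : ∀ t v → flowing (shift t v) ≡ flowing v
          shift-flowing t v = sym (isFlowing-transfer (lookup v) (lookup (shift t v)) λ {x} {y} x∼y → mk⇔
            (λ e → trans (lookup∘tabulate _ x) (trans (recolour-cong _ (lookup v) x∼y e) (sym (lookup∘tabulate _ y))))
            (λ e → recolour-≡ _ (σ-injective t v) (lookup v) x∼y (trans (sym (lookup∘tabulate _ x)) (trans e (lookup∘tabulate _ y)))))

          shift-a : ∀ t v → lookup (shift t v) a ≡ lookup v a
          shift-a t = recolourBy-a (λ s → transpose t s ⟨$⟩ʳ_)

          shift-b : ∀ t v → lookup (shift t v) b ≡ σ t v ⟨$⟩ʳ lookup v b
          shift-b t v = trans (lookup∘tabulate _ b) (recolour-inside _ (lookup v) refl)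

          shift-b≡a : ∀ t v → (lookup (shift t v) b == lookup (shift t v) a) ≡ (lookup v b == t)
          shift-b≡a t v = T-injective
            (λ h → Equivalence.from T-≡ (σ-injective t v (begin
              σ t v ⟨$⟩ʳ lookup v b    ≡⟨ shift-b t v ⟨
              lookup (shift t v) b    ≡⟨ Equivalence.to T-≡ h ⟩
              lookup (shift t v) a    ≡⟨ shift-a t v ⟩
              lookup v a              ≡⟨ σ-sends t v ⟨
              σ t v ⟨$⟩ʳ t            ∎)))
            (λ h → Equivalence.from T-≡ (begin
              lookup (shift t v) b    ≡⟨ shift-b t v ⟩
              σ t v ⟨$⟩ʳ lookup v b    ≡⟨ cong (σ t v ⟨$⟩ʳ_) (Equivalence.to T-≡ h) ⟩
              σ t v ⟨$⟩ʳ t            ≡⟨ σ-sends t v ⟩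
              lookup v a              ≡⟨ shift-a t v ⟨
              lookup (shift t v) a    ∎))

        -- shift t recolours the component of b by the transposition of t and c(a): a bijection from the
        -- flowing colourings with c(b) = t onto those with c(b) = c(a).
        τ-split : τ H k ≡ k * countTrue (λ v → isFlowing H (lookup v) ∧ (lookup v b == lookup v a)) (allVecs (n H) k)
        τ-split = begin
          countTrue flowing (allVecs (n H) k)
            ≡⟨ countTrue-fibres flowing (λ v → lookup v b) (allVecs (n H) k) ⟩
          ∑[ t < k ] countTrue (λ v → flowing v ∧ (lookup v b == t)) (allVecs (n H) k)
            ≡⟨ sum-cong-≗ fibre ⟩
          ∑[ t < k ] countTrue Q (allVecs (n H) k)
            ≡⟨ ∑-const k _ ⟩
          k * countTrue Q (allVecs (n H) k) ∎
          where
          Q : Colouring → Bool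
          Q v = flowing v ∧ (lookup v b == lookup v a)
          fibre : ∀ t → countTrue (λ v → flowing v ∧ (lookup v b == t)) (allVecs (n H) k) ≡ countTrue Q (allVecs (n H) k)
          fibre t = sym (trans (countTrue-allVecs-bijection (shift t) (unshift t) (unshift-shift t) (shift-unshift t) Q)
            (countTrue-cong (λ v → cong₂ _∧_ (shift-flowing t v) (shift-b≡a t v)) (allVecs (n H) k)))

module DeletionRank where
  open EdgeDeletion
  open Multipaths
  open Rank
  open ParallelEdges
  open import Data.Nat using (ℕ; suc)
  open import Data.Fin using (Fin; zero; suc)
  open import Data.Fin.Properties using (_≟_; any?)
  open import Data.Fin.Subset using (Subset; inside; outside; ⊤)
  open import Data.Fin.Subset.Properties using (drop-there; ∈⊤)
  open import Data.List.Membership.Propositional using () renaming (_∈_ to _∈ₗ_)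
  open ConsecutivePairs using (consecs)
  open import Data.Vec using (_∷_; here; there; _[_]≔_)
  open import Data.Product using (∃; _×_; _,_; proj₁; proj₂)
  open import Data.Sum using (_⊎_; inj₁; inj₂)
  open import Relation.Nullary using (¬_; Dec; contradiction)
  open import Relation.Nullary.Decidable using (_⊎-dec_)
  open import Function.Bundles using (mk⇔; Equivalence)
  open import Function.Definitions using (Injective)
  open import Relation.Binary.PropositionalEquality using (_≡_; _≢_; refl; sym)

  module _ {nn mm : ℕ} (edge₀ : Fin (suc mm) → Fin nn × Fin nn) (edge₀-inj : Injective _≡_ _≡_ edge₀) where

    open FirstEdge edge₀ edge₀-inj

    multipath⇒multipath⁻ : ∀ {B} → IsMultipath G (outside ∷ B) → IsMultipath G⁻ B
    multipath⇒multipath⁻ {B} (ps , u , edges) = ps , u , λ i → mk⇔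
      (λ i∈B → Equivalence.to (edges (suc i)) (there i∈B))
      (λ e∈ps → drop-there (Equivalence.from (edges (suc i)) e∈ps))

    multipath⁻⇒multipath : ∀ {B} → IsMultipath G⁻ B → IsMultipath G (outside ∷ B)
    multipath⁻⇒multipath {B} mp with multipath⇒realises G⁻ mp
    ... | ps , realises u pairs = realises⇒multipath G ps (realises u λ x → mk⇔ (to x) (from x))
      where
      to : ∀ x → x ∈ₗ consecs ps → EdgeIn G (outside ∷ B) x
      to x x∈ps = let (i , i∈B , e) = Equivalence.to (pairs x) x∈ps in suc i , there i∈B , e
      from : ∀ x → EdgeIn G (outside ∷ B) x → x ∈ₗ consecs ps
      from x (suc i , there i∈B , e) = Equivalence.from (pairs x) (i , i∈B , e)

    rank⁻ : ∀ {r} → IsRankFunction G r → IsRankFunction G⁻ (λ A → r (outside ∷ A))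
    rank⁻ {r} rank A with proj₁ (rank (outside ∷ A))
    ... | (outside ∷ B) , B⊆A , mp , ∣B∣≡r =
      (B , (λ i∈B → drop-there (B⊆A (there i∈B))) , multipath⇒multipath⁻ mp , ∣B∣≡r) ,
      λ B′ B′⊆A mp′ → proj₂ (rank (outside ∷ A)) (outside ∷ B′) (λ { (there i∈B′) → there (B′⊆A i∈B′) }) (multipath⁻⇒multipath mp′)
    ... | (inside ∷ B) , B⊆A , _ , _ with B⊆A here
    ...   | ()

    Shares : Fin mm → Set
    Shares f = src G⁻ f ≡ u ⊎ tgt G⁻ f ≡ v

    shares? : Dec (∃ Shares)
    shares? = any? λ f → (src G⁻ f ≟ u) ⊎-dec (tgt G⁻ f ≟ v)

    shares⇒parallel : MP1 G → IsForest G → ∀ {f} → Shares f → Parallel G zero (suc f)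
    shares⇒parallel mp1 forest (inj₁ e) = shared-source⇒parallel G mp1 forest (λ ()) (sym e)
    shares⇒parallel mp1 forest (inj₂ e) = shared-target⇒parallel G mp1 forest (λ ()) (sym e)

    module _ (forest : IsForest G) {r : Subset (suc mm) → ℕ} (rank : IsRankFunction G r) where

      rank-coloop : ¬ ∃ Shares → ∀ A → r (inside ∷ A) ≡ suc (r (outside ∷ A))
      rank-coloop no-sharing A = rank-insert-free G r rank forest {outside ∷ A} {zero} (λ ()) src-free tgt-free
        where
        src-free : ∀ {j} → j ≢ zero → src G j ≢ u
        src-free {zero}  0≢0 = contradiction refl 0≢0
        src-free {suc f} _   = λ e → no-sharing (f , inj₁ e)
        tgt-free : ∀ {j} → j ≢ zero → tgt G j ≢ v
        tgt-free {zero}  0≢0 = contradiction refl 0≢0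
        tgt-free {suc f} _   = λ e → no-sharing (f , inj₂ e)

      rank-parallel-⊤ : ∀ {f} → Parallel G zero (suc f) → r (inside ∷ ⊤) ≡ r (outside ∷ ⊤)
      rank-parallel-⊤ par = rank-insert-parallel G r rank forest {outside ∷ ⊤} par (there ∈⊤)

      rank-parallel-insert : ∀ {f} → Parallel G zero (suc f) → ∀ A → r (inside ∷ A [ f ]≔ inside) ≡ r (inside ∷ A)
      rank-parallel-insert par A = rank-insert-parallel G r rank forest {inside ∷ A} (Parallel-sym G par) here

module DeletionColourings where
  open EdgeDeletion
  open Components
  open Counting
  open FlowingColourings
  open Rank
  open ParallelEdges
  open DeletionRank
  open Recolouring
  open import Data.Nat using (ℕ; suc; _+_; _*_)
  open import Data.Bool using (Bool; T; not; _∧_)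
  open import Data.Bool.Properties using (T-∧)
  open import Data.Fin using (Fin; zero; suc)
  open import Data.Vec using (Vec; lookup)
  open import Data.Product using (∃; _×_; _,_)
  open import Data.Sum using (inj₁; inj₂)
  open import Function using (_∘_)
  open import Function.Bundles using (_⇔_; Equivalence)
  open import Function.Definitions using (Injective)
  open import Relation.Nullary using (¬_)
  open import Data.Empty using (⊥-elim)
  open import Relation.Binary.PropositionalEquality using (_≡_; _≢_; refl; sym; trans; cong)

  module _ {nn mm : ℕ} (edge₀ : Fin (suc mm) → Fin nn × Fin nn) (edge₀-inj : Injective _≡_ _≡_ edge₀) where

    open FirstEdge edge₀ edge₀-inj

    module _ {k : ℕ} (c : Fin nn → Fin k) where

      flowing⇒flowing⁻ : Flowing G c → Flowing G⁻ c
      flowing⇒flowing⁻ flowing = record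
        { proper        = proper ∘ suc
        ; sources-agree = λ i j → sources-agree (suc i) (suc j)
        ; targets-agree = λ i j → targets-agree (suc i) (suc j)
        }
        where open Flowing flowing

      isFlowing-split : ∀ {b : Bool} {P : Set} → (T b ⇔ P) → (Flowing G c → P) → (Flowing G⁻ c → P → Flowing G c) →
        isFlowing G c ≡ isFlowing G⁻ c ∧ b
      isFlowing-split b⇔P P-of back = T-injective
        (λ h → let flowing = Equivalence.to (isFlowing⇔Flowing G c) h in Equivalence.from T-∧
          (Equivalence.from (isFlowing⇔Flowing G⁻ c) (flowing⇒flowing⁻ flowing) , Equivalence.from b⇔P (P-of flowing)))
        (λ h → let (h⁻ , hb) = Equivalence.to T-∧ h in Equivalence.from (isFlowing⇔Flowing G c)
          (back (Equivalence.to (isFlowing⇔Flowing G⁻ c) h⁻) (Equivalence.to b⇔P hb)))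

      flowing-coloop : ¬ ∃ (Shares edge₀ edge₀-inj) → Flowing G⁻ c → c v ≢ c u → Flowing G c
      flowing-coloop no-sharing flowing cv≢cu = record { proper = proper′ ; sources-agree = sources′ ; targets-agree = targets′ }
        where
        open Flowing flowing
        proper′ : ∀ i → c (src G i) ≢ c (tgt G i)
        proper′ zero    = cv≢cu ∘ sym
        proper′ (suc i) = proper i
        sources′ : ∀ i j → tgt G i ≡ tgt G j → c (src G i) ≡ c (src G j)
        sources′ zero    zero    _ = refl
        sources′ zero    (suc j) e = ⊥-elim (no-sharing (j , inj₂ (sym e)))
        sources′ (suc i) zero    e = ⊥-elim (no-sharing (i , inj₂ e))
        sources′ (suc i) (suc j) e = sources-agree i j e
        targets′ : ∀ i j → src G i ≡ src G j → c (tgt G i) ≡ c (tgt G j)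
        targets′ zero    zero    _ = refl
        targets′ zero    (suc j) e = ⊥-elim (no-sharing (j , inj₁ (sym e)))
        targets′ (suc i) zero    e = ⊥-elim (no-sharing (i , inj₁ e))
        targets′ (suc i) (suc j) e = targets-agree i j e

      flowing-shared-source : ∀ {f} → SoleIn G zero → src G⁻ f ≡ u → Flowing G⁻ c → c v ≡ c (tgt G⁻ f) → Flowing G c
      flowing-shared-source {f} sole uf flowing cv≡ = record { proper = proper′ ; sources-agree = sources′ ; targets-agree = targets′ }
        where
        open Flowing flowing
        proper′ : ∀ i → c (src G i) ≢ c (tgt G i)
        proper′ zero    e = proper f (trans (cong c uf) (trans e cv≡))
        proper′ (suc i)   = proper i
        sources′ : ∀ i j → tgt G i ≡ tgt G j → c (src G i) ≡ c (src G j)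
        sources′ zero    zero    _ = refl
        sources′ zero    (suc j) e with sole (suc j) (sym e)
        ... | ()
        sources′ (suc i) zero    e with sole (suc i) e
        ... | ()
        sources′ (suc i) (suc j) e = sources-agree i j e
        targets′ : ∀ i j → src G i ≡ src G j → c (tgt G i) ≡ c (tgt G j)
        targets′ zero    zero    _ = refl
        targets′ zero    (suc j) e = trans cv≡ (targets-agree f j (trans uf e))
        targets′ (suc i) zero    e = sym (trans cv≡ (targets-agree f i (trans uf (sym e))))
        targets′ (suc i) (suc j) e = targets-agree i j e

      flowing-shared-target : ∀ {f} → SoleOut G zero → tgt G⁻ f ≡ v → Flowing G⁻ c → c u ≡ c (src G⁻ f) → Flowing G c
      flowing-shared-target {f} sole vf flowing cu≡ = record { proper = proper′ ; sources-agree = sources′ ; targets-agree = targets′ }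
        where
        open Flowing flowing
        proper′ : ∀ i → c (src G i) ≢ c (tgt G i)
        proper′ zero    e = proper f (trans (sym cu≡) (trans e (cong c (sym vf))))
        proper′ (suc i)   = proper i
        sources′ : ∀ i j → tgt G i ≡ tgt G j → c (src G i) ≡ c (src G j)
        sources′ zero    zero    _ = refl
        sources′ zero    (suc j) e = trans cu≡ (sources-agree f j (trans vf e))
        sources′ (suc i) zero    e = sym (trans cu≡ (sources-agree f i (trans vf (sym e))))
        sources′ (suc i) (suc j) e = sources-agree i j e
        targets′ : ∀ i j → src G i ≡ src G j → c (tgt G i) ≡ c (tgt G j)
        targets′ zero    zero    _ = refl
        targets′ zero    (suc j) e with sole (suc j) (sym e)
        ... | ()
        targets′ (suc i) zero    e with sole (suc i) e
        ... | ()
        targets′ (suc i) (suc j) e = targets-agree i j e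

    module _ {p} (IC⁻ : IsNumComponents G⁻ p) (u≁v : component G⁻ IC⁻ u ≢ component G⁻ IC⁻ v) (k : ℕ) where

      private
        flowing⁻ : Vec (Fin k) nn → Bool
        flowing⁻ w = isFlowing G⁻ (lookup w)

        flowing⁻-with : (Vec (Fin k) nn → Bool) → ℕ
        flowing⁻-with P = countTrue (λ w → flowing⁻ w ∧ P w) (allVecs nn k)

      τ-coloop : ¬ ∃ (Shares edge₀ edge₀-inj) → ∃ λ X → τ G⁻ k ≡ k * X × τ G⁻ k ≡ X + τ G k
      τ-coloop no-sharing = X , τ-split G⁻ IC⁻ v u u≁v , trans (countTrue-∧-split flowing⁻ v≡u (allVecs nn k)) (cong (X +_) (sym τ≡))
        where
        v≡u : Vec (Fin k) nn → Bool
        v≡u w = lookup w v == lookup w u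
        X : ℕ
        X = flowing⁻-with v≡u
        τ≡ : τ G k ≡ flowing⁻-with (not ∘ v≡u)
        τ≡ = countTrue-cong (λ w → isFlowing-split (lookup w) T-≢ (λ fl e → Flowing.proper fl zero (sym e))
          (flowing-coloop (lookup w) no-sharing)) (allVecs nn k)

      τ-shared : MP1 G → IsForest G → ∀ {f} → Shares edge₀ edge₀-inj f → τ G⁻ k ≡ k * τ G k
      τ-shared mp1 forest {f} (inj₁ uf) = trans (τ-split G⁻ IC⁻ v (tgt G⁻ f) tf≁v) (cong (k *_) (sym τ≡))
        where
        comp : Fin nn → Fin p
        comp = component G⁻ IC⁻
        tf≁v : comp (tgt G⁻ f) ≢ comp v
        tf≁v e = u≁v (trans (cong comp (sym uf)) (trans (edge-same-component G⁻ IC⁻ f) e))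
        τ≡ : τ G k ≡ flowing⁻-with (λ w → lookup w v == lookup w (tgt G⁻ f))
        τ≡ = countTrue-cong (λ w → isFlowing-split (lookup w) T-≡ (λ fl → Flowing.targets-agree fl zero (suc f) (sym uf))
          (flowing-shared-source (lookup w) (shared-source⇒SoleIn G mp1 forest (λ ()) (sym uf)) uf)) (allVecs nn k)
      τ-shared mp1 forest {f} (inj₂ vf) = trans (τ-split G⁻ IC⁻ u (src G⁻ f) sf≁u) (cong (k *_) (sym τ≡))
        where
        comp : Fin nn → Fin p
        comp = component G⁻ IC⁻
        sf≁u : comp (src G⁻ f) ≢ comp u
        sf≁u e = u≁v (trans (sym e) (trans (edge-same-component G⁻ IC⁻ f) (cong comp vf)))
        τ≡ : τ G k ≡ flowing⁻-with (λ w → lookup w u == lookup w (src G⁻ f))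
        τ≡ = countTrue-cong (λ w → isFlowing-split (lookup w) T-≡ (λ fl → Flowing.sources-agree fl zero (suc f) (sym vf))
          (flowing-shared-target (lookup w) (shared-target⇒SoleOut G mp1 forest (λ ()) (sym vf)) vf)) (allVecs nn k)

module Induction where
  open EdgeDeletion
  open Components
  open Counting
  open Rank
  open TutteSums
  open DeletionRank
  open DeletionColourings
  open import Data.Nat as ℕ using (ℕ; zero; suc)
  open import Data.Nat.Properties using (n∸n≡0; 0∸n≡0; n≤0⇒n≡0; +-cancelˡ-≡)
  open import Data.Integer using (ℤ; +_; _+_; _-_; _*_; _^_; -1ℤ; 0ℤ; 1ℤ)
  open import Data.Integer.Properties using (*-cancelˡ-≡; pos-*; *-identityʳ; *-identityˡ; *-zeroˡ; *-zeroʳ; *-assoc)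
  open import Data.Integer.Solver using (module +-*-Solver)
  open +-*-Solver using (solve; _:+_; _:*_; _:-_; _:=_; con)
  open import Data.Fin using (Fin; zero; suc)
  open import Data.Fin.Subset using (Subset; inside; outside; ⊤)
  open import Data.Fin.Subset.Properties using (∈⊤)
  open import Data.Vec using ([]; _∷_; there)
  open import Data.List using ([])
  open import Data.Product using (∃; _×_; _,_)
  open import Relation.Nullary using (¬_; yes; no)
  open import Function.Definitions using (Injective)
  open import Relation.Binary.PropositionalEquality using (_≡_; refl; sym; trans; cong; cong₂)
  open Relation.Binary.PropositionalEquality.≡-Reasoning

  TutteFlowEquation : (G : Digraph) → (Subset (m G) → ℕ) → ℕ → ℕ → Set
  TutteFlowEquation G r p₀ k = (+ k) ^ p₀ * TutteAt G r (+ 1 - + k) 0ℤ ≡ -1ℤ ^ r ⊤ * + τ G k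

  TutteFlowIdentity : Digraph → Set
  TutteFlowIdentity G = (r : Subset (m G) → ℕ) → IsRankFunction G r → (p₀ : ℕ) → IsNumComponents G p₀ →
    (k : ℕ) → TutteFlowEquation G r p₀ k

  +-^ : ∀ k n → (+ k) ^ n ≡ + (k ℕ.^ n)
  +-^ k zero    = refl
  +-^ k (suc n) = trans (cong (+ k *_) (+-^ k n)) (sym (pos-* k (k ℕ.^ n)))

  no-colourings : ∀ t → Fin t → allVecs t 0 ≡ []
  no-colourings (suc t) _ = refl

  τ-no-colours : ∀ G → Fin (n G) → τ G 0 ≡ 0
  τ-no-colours G x = cong (countTrue _) (no-colourings (n G) x)

  edgeless-identity : ∀ {nn} (edge : Fin 0 → Fin nn × Fin nn) (edge-inj : Injective _≡_ _≡_ edge) →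
    TutteFlowIdentity (record { n = nn ; m = 0 ; edge = edge ; edge-inj = edge-inj })
  edgeless-identity {nn} edge edge-inj r rank p₀ IC k = begin
    (+ k) ^ p₀ * ((+ 1 - + k - + 1) ^ (r [] ℕ.∸ r []) * (0ℤ - + 1) ^ (0 ℕ.∸ r []))
      ≡⟨ cong₂ (λ p e → (+ k) ^ p * ((+ 1 - + k - + 1) ^ (r [] ℕ.∸ r []) * (0ℤ - + 1) ^ e)) p₀≡nn (0∸n≡0 (r [])) ⟩
    (+ k) ^ nn * ((+ 1 - + k - + 1) ^ (r [] ℕ.∸ r []) * 1ℤ)
      ≡⟨ cong (λ e → (+ k) ^ nn * ((+ 1 - + k - + 1) ^ e * 1ℤ)) (n∸n≡0 (r [])) ⟩
    (+ k) ^ nn * 1ℤ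
      ≡⟨ trans (*-identityʳ _) (+-^ k nn) ⟩
    + (k ℕ.^ nn)
      ≡⟨ cong +_ (sym (trans (countTrue-true (allVecs nn k)) (length-allVecs nn k))) ⟩
    + τ G k
      ≡⟨ *-identityˡ _ ⟨
    -1ℤ ^ 0 * + τ G k
      ≡⟨ cong (λ e → -1ℤ ^ e * + τ G k) (n≤0⇒n≡0 (rank≤size G r rank [])) ⟨
    -1ℤ ^ r [] * + τ G k ∎
    where
    G : Digraph
    G = record { n = nn ; m = 0 ; edge = edge ; edge-inj = edge-inj }
    p₀≡nn : p₀ ≡ nn
    p₀≡nn = numComponents-unique {G} IC (edgeless-components edge edge-inj)

  cancel-colour-factor : ∀ k′ p (T s : ℤ) {τ⁻} Y → τ⁻ ≡ suc k′ ℕ.* Y →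
    (+ suc k′) ^ suc p * T ≡ s * + τ⁻ → (+ suc k′) ^ p * T ≡ s * + Y
  cancel-colour-factor k′ p T s Y refl eq = *-cancelˡ-≡ K _ _ (begin
    K * (K ^ p * T)      ≡⟨ *-assoc K (K ^ p) T ⟨
    K ^ suc p * T        ≡⟨ eq ⟩
    s * + (suc k′ ℕ.* Y) ≡⟨ cong (s *_) (pos-* (suc k′) Y) ⟩
    s * (K * + Y)        ≡⟨ solve 3 (λ s K Y → s :* (K :* Y) := K :* (s :* Y)) refl s K (+ Y) ⟩
    K * (s * + Y)        ∎)
    where
    K : ℤ
    K = + suc k′

  module _ {nn mm : ℕ} (edge₀ : Fin (suc mm) → Fin nn × Fin nn) (edge₀-inj : Injective _≡_ _≡_ edge₀) where

    open FirstEdge edge₀ edge₀-inj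

    private
      restrict : (Subset (suc mm) → ℕ) → Subset mm → ℕ
      restrict r A = r (outside ∷ A)

    coloop-step : IsForest G → ∀ {r} → IsRankFunction G r → ¬ ∃ (Shares edge₀ edge₀-inj) → ∀ {p k′} →
      (∃ λ X → τ G⁻ (suc k′) ≡ suc k′ ℕ.* X × τ G⁻ (suc k′) ≡ X ℕ.+ τ G (suc k′)) →
      TutteFlowEquation G⁻ (restrict r) (suc p) (suc k′) → TutteFlowEquation G r p (suc k′)
    coloop-step forest {r} rank no-sharing {p} {k′} (X , τ⁻≡KX , τ⁻≡X+τ) ih⁻ = begin
      K ^ p * TutteAt G r x 0ℤ
        ≡⟨ cong (K ^ p *_) (tutte-coloop r x r-coloop r⁻-mono) ⟩
      K ^ p * (x * T⁻)
        ≡⟨ solve 3 (λ P x T → P :* (x :* T) := x :* (P :* T)) refl (K ^ p) x T⁻ ⟩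
      x * (K ^ p * T⁻)
        ≡⟨ cong (x *_) (cancel-colour-factor k′ p T⁻ s X τ⁻≡KX ih⁻) ⟩
      x * (s * + X)
        ≡⟨ solve 3 (λ k s X → (con (+ 1) :- (con (+ 1) :+ k)) :* (s :* X) := (con -1ℤ :* s) :* (k :* X)) refl (+ k′) s (+ X) ⟩
      (-1ℤ * s) * (+ k′ * + X)
        ≡⟨ cong₂ (λ e t → -1ℤ ^ e * t) (sym (r-coloop ⊤)) (sym (trans (cong +_ τ≡k′X) (pos-* k′ X))) ⟩
      -1ℤ ^ r ⊤ * + τ G (suc k′) ∎
      where
      K x s T⁻ : ℤ
      K  = + suc k′
      x  = + 1 - K
      s  = -1ℤ ^ restrict r ⊤
      T⁻ = TutteAt G⁻ (restrict r) x 0ℤ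
      r-coloop : ∀ A → r (inside ∷ A) ≡ suc (r (outside ∷ A))
      r-coloop = rank-coloop edge₀ edge₀-inj forest rank no-sharing
      r⁻-mono : ∀ A → r (outside ∷ A) ℕ.≤ r (outside ∷ ⊤)
      r⁻-mono A = rank-mono G r rank λ { (there _) → there ∈⊤ }
      τ≡k′X : τ G (suc k′) ≡ k′ ℕ.* X
      τ≡k′X = +-cancelˡ-≡ X _ _ (trans (sym τ⁻≡X+τ) τ⁻≡KX)

    parallel-step : IsForest G → ∀ {r} → IsRankFunction G r → ∀ {f} → Parallel G zero (suc f) → ∀ {p k′} →
      τ G⁻ (suc k′) ≡ suc k′ ℕ.* τ G (suc k′) →
      TutteFlowEquation G⁻ (restrict r) (suc p) (suc k′) → TutteFlowEquation G r p (suc k′)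
    parallel-step forest {r} rank {f} par {p} {k′} τ⁻≡Kτ ih⁻ = begin
      K ^ p * TutteAt G r x 0ℤ
        ≡⟨ cong (K ^ p *_) (tutte-parallel r x f r-⊤ (λ A _ → rank-parallel-insert edge₀ edge₀-inj forest rank par A) (rank≤size G r rank)) ⟩
      K ^ p * TutteAt G⁻ (restrict r) x 0ℤ
        ≡⟨ cancel-colour-factor k′ p (TutteAt G⁻ (restrict r) x 0ℤ) (-1ℤ ^ restrict r ⊤) (τ G (suc k′)) τ⁻≡Kτ ih⁻ ⟩
      -1ℤ ^ restrict r ⊤ * + τ G (suc k′)
        ≡⟨ cong (λ e → -1ℤ ^ e * + τ G (suc k′)) r-⊤ ⟨
      -1ℤ ^ r ⊤ * + τ G (suc k′) ∎
      where
      K x : ℤ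
      K = + suc k′
      x = + 1 - K
      r-⊤ : r (inside ∷ ⊤) ≡ r (outside ∷ ⊤)
      r-⊤ = rank-parallel-⊤ edge₀ edge₀-inj forest rank par

    deletion-step : (MP1 G⁻ → IsForest G⁻ → TutteFlowIdentity G⁻) → MP1 G → IsForest G → TutteFlowIdentity G
    deletion-step ih mp1 forest r rank zero IC k with component G IC u
    ... | ()
    deletion-step ih mp1 forest r rank (suc q) IC zero = begin
      (+ 0) ^ suc q * TutteAt G r (+ 1 - + 0) 0ℤ ≡⟨ *-zeroˡ (TutteAt G r (+ 1 - + 0) 0ℤ) ⟩
      0ℤ                                        ≡⟨ *-zeroʳ (-1ℤ ^ r ⊤) ⟨
      -1ℤ ^ r ⊤ * + 0                           ≡⟨ cong (λ t → -1ℤ ^ r ⊤ * + t) (τ-no-colours G u) ⟨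
      -1ℤ ^ r ⊤ * + τ G 0                       ∎
    deletion-step ih mp1 forest r rank p@(suc _) IC (suc k′) with components-delete-bridge edge₀ edge₀-inj forest IC
    ... | IC⁻ , u≁v with ih (MP1⁻ mp1) (forest⁻ forest) (restrict r) (rank⁻ edge₀ edge₀-inj rank) (suc p) IC⁻ (suc k′)
                       | shares? edge₀ edge₀-inj
    ...   | ih⁻ | no  no-sharing    = coloop-step forest rank no-sharing {p} {k′} (τ-coloop edge₀ edge₀-inj IC⁻ u≁v (suc k′) no-sharing) ih⁻
    ...   | ih⁻ | yes (_ , sharing) = parallel-step forest rank (shares⇒parallel edge₀ edge₀-inj mp1 forest sharing) {p} {k′}
                                        (τ-shared edge₀ edge₀-inj IC⁻ u≁v (suc k′) mp1 forest sharing) ih⁻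

  tutte-flow-identity : ∀ G → MP1 G → IsForest G → TutteFlowIdentity G
  tutte-flow-identity = edge-induction (λ G → MP1 G → IsForest G → TutteFlowIdentity G)
    (λ edge edge-inj _ _ → edgeless-identity edge edge-inj) deletion-step

open Induction using (tutte-flow-identity)
open import Data.Nat using (ℕ)
open import Data.Integer using (+_; _-_; _*_; _^_; -1ℤ; 0ℤ)
open import Data.Fin.Subset using (Subset; ⊤)
open import Data.Product using (_,_)
open import Relation.Binary.PropositionalEquality using (_≡_)

corollary5p11 : (G : Digraph) → MPForest G →
                (r : Subset (m G) → ℕ) → IsRankFunction G r →
                (p₀ : ℕ) → IsNumComponents G p₀ →
                (k : ℕ) →
                (+ k) ^ p₀ * TutteAt G r (+ 1 - + k) 0ℤ ≡ -1ℤ ^ r ⊤ * + τ G k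
corollary5p11 G ((mp1 , _) , forest) = tutte-flow-identity G mp1 forest
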